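{- Let $B$ be the $N\times N$ skew-symmetric integer matrix of a quiver of mutation period $1$, i.e. $\mu_1B=\rho B\rho^{ -1}$. Set $m_j=b_{j+1,1}$ for $1\le j\le N-1$ and $\varepsilon_{ij}=\frac12(m_i|m_j|-m_j|m_i|)$. Then: (1) if $N=2r$, $B=\widetilde B_{2r}(m_1,\dots,m_r)+\sum_{k=1}^{r-1}\widetilde B_{2(r-k)}(\varepsilon_{k,k+1},\dots,\varepsilon_{kr})$, where the $2(r-k)\times 2(r-k)$ matrix $\widetilde B_{2(r-k)}(\varepsilon_{k,k+1},\dots,\varepsilon_{kr})$ is embedded in a $2r\times 2r$ matrix in rows and columns $k+1,\dots,2r-k$ (all other entries zero); (2) if $N=2r+1$, $B=\widetilde B_{2r+1}(m_1,\dots,m_r)+\sum_{k=1}^{r-1}\widetilde B_{2(r-k)+1}(\varepsilon_{k,k+1},\dots,\varepsilon_{kr})$, where $\widetilde B_{2(r-k)+1}(\varepsilon_{k,k+1},\dots,\varepsilon_{kr})$ is embedded in a $(2r+1)\times(2r+1)$ matrix in rows and columns $k+1,\dots,2r+1-k$ (all other entries zero).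
   Context: Mutation at $k$: $\mu_kB=\tilde B$ with $\tilde b_{ij}=-b_{ij}$ if $i=k$ or $j=k$, else $\tilde b_{ij}=b_{ij}+\frac12(|b_{ik}|b_{kj}+b_{ik}|b_{kj}|)$. $\rho$: $N\times N$ permutation matrix with $\rho_{i+1,i}=1$ ($1\le i\le N-1$), $\rho_{1,N}=1$, others $0$. For $n\ge2$, $\tau_n$ is the $n\times n$ matrix with $(\tau_n)_{i+1,i}=1$ ($1\le i\le n-1$), $(\tau_n)_{1,n}=-1$, others $0$. Write $n=2s$ or $n=2s+1$. For $1\le k\le s$, $R_n^{(k)}$ is the skew-symmetric $n\times n$ matrix with $(R_n^{(k)})_{n-k+1,1}=1$, $(R_n^{(k)})_{1,n-k+1}=-1$, others $0$. The primitives are $B_n^{(k)}=\sum_{i=0}^{n-1}\tau_n^iR_n^{(k)}\tau_n^{ -i}$ if $n=2s+1$, $1\le k\le s$, or $n=2s$, $1\le k\le s-1$; and $B_{2s}^{(s)}=\sum_{i=0}^{s-1}\tau_{2s}^iR_{2s}^{(s)}\tau_{2s}^{ -i}$. For integers $\mu_1,\dots,\mu_s$, $\widetilde B_n(\mu_1,\dots,\mu_s)=\sum_{j=1}^s\mu_jB_n^{(j)}$. -}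

module Defs where

open import Data.Nat as ℕ using (ℕ; zero; suc; _∸_; _≤?_; _<?_)
open import Data.Fin as Fin using (Fin; toℕ)
open import Data.Integer using (ℤ; +_; -_; ∣_∣; _/_) renaming (_+_ to _+ℤ_; _*_ to _*ℤ_; _-_ to _-ℤ_)
open import Data.Bool using (Bool; true; false; if_then_else_; _∧_; _∨_)
open import Relation.Nullary.Decidable using (⌊_⌋; yes; no)
open import Relation.Binary.PropositionalEquality using (_≡_)

-- Square integer matrices, indexed 0-based by Fin n.
Mat : ℕ → Set
Mat n = Fin n → Fin n → ℤ

_≈ₘ_ : ∀ {n} → Mat n → Mat n → Set
A ≈ₘ B = ∀ i j → A i j ≡ B i j

SkewSymmetric : ∀ {n} → Mat n → Set
SkewSymmetric B = ∀ i j → B i j ≡ - B j i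

-- 1-based position of a Fin index
pos : ∀ {n} → Fin n → ℕ
pos a = suc (toℕ a)

infix 4 _==_ _≤ᵇ_
_==_ : ℕ → ℕ → Bool
m == n = ⌊ m ℕ.≟ n ⌋

_≤ᵇ_ : ℕ → ℕ → Bool
m ≤ᵇ n = ⌊ m ≤? n ⌋

∑ : ∀ {n} → (Fin n → ℤ) → ℤ
∑ {zero} f = + 0
∑ {suc n} f = f Fin.zero +ℤ ∑ (λ i → f (Fin.suc i))

0ₘ : ∀ {n} → Mat n
0ₘ i j = + 0

_+ₘ_ : ∀ {n} → Mat n → Mat n → Mat n
(A +ₘ B) i j = A i j +ℤ B i j

_*ₘ_ : ∀ {n} → Mat n → Mat n → Mat n
(A *ₘ B) i j = ∑ (λ l → A i l *ℤ B l j)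

_·ₘ_ : ∀ {n} → ℤ → Mat n → Mat n
(c ·ₘ A) i j = c *ℤ A i j

idₘ : ∀ {n} → Mat n
idₘ i j = if toℕ i == toℕ j then + 1 else + 0

transpose : ∀ {n} → Mat n → Mat n
transpose A i j = A j i

_^ₘ_ : ∀ {n} → Mat n → ℕ → Mat n
A ^ₘ zero = idₘ
A ^ₘ suc k = A *ₘ (A ^ₘ k)

sumMat0 : ∀ {n} → ℕ → (ℕ → Mat n) → Mat n
sumMat0 zero f = 0ₘ
sumMat0 (suc c) f = sumMat0 c f +ₘ f c

sumMat1 : ∀ {n} → ℕ → (ℕ → Mat n) → Mat n
sumMat1 c f = sumMat0 c (λ i → f (suc i))

-- Mutation at k:  b~_ij = -b_ij if i = k or j = k,
-- else b_ij + (|b_ik| b_kj + b_ik |b_kj|)/2   (the numerator is always even)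
mutate : ∀ {n} → Fin n → Mat n → Mat n
mutate k B i j =
  if (toℕ i == toℕ k) ∨ (toℕ j == toℕ k)
  then - B i j
  else B i j +ℤ ((+ ∣ B i k ∣ *ℤ B k j +ℤ B i k *ℤ + ∣ B k j ∣) / + 2)

ρ : ∀ {N} → Mat N
ρ {N} a b =
  if ((pos a == suc (pos b)) ∧ (pos b ≤ᵇ (N ∸ 1))) ∨ ((pos a == 1) ∧ (pos b == N))
  then + 1 else + 0

-- ρ is a permutation matrix, so ρ⁻¹ is its transpose
ρ⁻¹ : ∀ {N} → Mat N
ρ⁻¹ = transpose ρ

-- mutation period 1 : μ_1 B = ρ B ρ⁻¹  (vertex 1 is the Fin index with toℕ = 0)
MutationPeriod1 : ∀ {N} → Mat N → Set
MutationPeriod1 {N} B = ∀ (k : Fin N) → toℕ k ≡ 0 → mutate k B ≈ₘ (ρ *ₘ (B *ₘ ρ⁻¹))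

τ : ∀ {n} → Mat n
τ {n} a b =
  if (pos a == suc (pos b)) ∧ (pos b ≤ᵇ (n ∸ 1)) then + 1
  else if (pos a == 1) ∧ (pos b == n) then - (+ 1) else + 0

-- τ_n is a signed permutation matrix, so τ_n⁻¹ is its transpose
τ⁻¹ : ∀ {n} → Mat n
τ⁻¹ = transpose τ

R : ∀ {n} → ℕ → Mat n
R {n} k a b =
  if (pos a == (n ∸ k) ℕ.+ 1) ∧ (pos b == 1) then + 1
  else if (pos a == 1) ∧ (pos b == (n ∸ k) ℕ.+ 1) then - (+ 1) else + 0

-- primitive B_n^{(k)} : sum_{i=0}^{n-1} τ^i R τ^{-i}, except for n = 2k
-- (i.e. n = 2s, k = s) where the sum runs over i = 0..s-1.
prim : (n k : ℕ) → Mat n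
prim n k = sumMat0 (if n == k ℕ.+ k then k else n)
                   (λ i → (τ ^ₘ i) *ₘ (R k *ₘ (τ⁻¹ ^ₘ i)))

Btilde : (n s : ℕ) → (ℕ → ℤ) → Mat n
Btilde n s μ = sumMat1 s (λ j → μ j ·ₘ prim n j)

-- 0-based access with zero outside the matrix
at : ∀ {m} → Mat m → ℕ → ℕ → ℤ
at {m} M i j with i <? m | j <? m
... | yes p | yes q = M (Fin.fromℕ< p) (Fin.fromℕ< q)
... | _ | _ = + 0

-- 1-based entry b_{ij} (zero outside range; only used in range)
entry : ∀ {N} → Mat N → ℕ → ℕ → ℤ
entry B i j = at B (i ∸ 1) (j ∸ 1)

-- embed an m×m matrix M into N×N rows/columns k+1,…,k+m (1-based); zero elsewhere
embed : ∀ {m N} → ℕ → Mat m → Mat N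
embed k M a b = if (k ≤ᵇ toℕ a) ∧ (k ≤ᵇ toℕ b) then at M (toℕ a ∸ k) (toℕ b ∸ k) else + 0

mcoef : ∀ {N} → Mat N → ℕ → ℤ
mcoef B j = entry B (suc j) 1

-- ε_ij = (m_i |m_j| - m_j |m_i|)/2   (numerator is always even)
ε : ∀ {N} → Mat N → ℕ → ℕ → ℤ
ε B i j = (mcoef B i *ℤ + ∣ mcoef B j ∣ -ℤ mcoef B j *ℤ + ∣ mcoef B i ∣) / + 2

module Submission where

-- Mutation at vertex 1 compares B with ρBρ⁻¹ entrywise.  Writing m_j = b_{j+1,1}, so that b_{1,j+1} = -m_j,
-- it gives b_{i+1,j+1} = b_{ij} - ε_{ij} and b_{N,j} = m_j.  Hence a skew-symmetric B of period 1 is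
-- determined by its first column, and following the subdiagonal that ends in the last row shows that m is a
-- palindrome, m_{N-j} = m_j, since the ε-terms collected along it cancel in pairs.
-- The right-hand side has the same three properties.  B~_n(μ) is skew-symmetric and constant along
-- subdiagonals, with μ_d on the d-th one and μ_{n-d} beyond the middle, so its first column is m by the
-- palindrome.  Moving one step down a subdiagonal of the sum, exactly one embedded block enters the range
-- (contributing -ε) or leaves it (contributing +ε), or none does, and then ε vanishes by the palindrome.

open import Defs
open import Data.Nat using (ℕ; suc; _+_; _∸_)
open import Data.Product using (_×_)
open import Data.Bool using (true; false; if_then_else_; _∧_; _∨_)
open import Data.Bool.Properties using (∧-zeroʳ)
open import Data.Fin as Fin using (Fin; toℕ; fromℕ<)
open import Data.Fin.Properties using (toℕ-fromℕ<; fromℕ<-toℕ; toℕ<n)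
open import Data.Integer using (ℤ; +_; -_; -[1+_]; ∣_∣; _/_) renaming (_+_ to _+ℤ_; _*_ to _*ℤ_; _-_ to _-ℤ_)
import Data.Integer.Properties as ℤₚ
open import Data.Integer.Tactic.RingSolver using (solve-∀)
open import Data.Nat as ℕ using (zero; _<_; _≤_; _≟_; _≤?_; _<?_; z≤n; s≤s)
import Data.Nat.DivMod as DivMod
open import Data.Nat.Induction using (<-rec)
import Data.Nat.Properties as ℕₚ
open import Data.Nat.Tactic.RingSolver using () renaming (solve-∀ to ℕ-solve-∀)
open import Data.Product using (_,_; ∃)
open import Data.Sum using (_⊎_; inj₁; inj₂)
open import Relation.Binary.Definitions using (tri<; tri≈; tri>)
open import Relation.Binary.PropositionalEquality
open import Relation.Nullary using (¬_; Dec; yes; no; contradiction)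
open import Relation.Nullary.Decidable using (⌊_⌋; _×-dec_)

==-true : ∀ {m n} → m ≡ n → (m == n) ≡ true
==-true {m} {n} m≡n with m ≟ n
... | yes _ = refl
... | no m≢n = contradiction m≡n m≢n

==-false : ∀ {m n} → m ≢ n → (m == n) ≡ false
==-false {m} {n} m≢n with m ≟ n
... | yes m≡n = contradiction m≡n m≢n
... | no _ = refl

≤ᵇ-true : ∀ {m n} → m ≤ n → (m ≤ᵇ n) ≡ true
≤ᵇ-true {m} {n} m≤n with m ≤? n
... | yes _ = refl
... | no m≰n = contradiction m≤n m≰n

≤ᵇ-false : ∀ {m n} → ¬ m ≤ n → (m ≤ᵇ n) ≡ false
≤ᵇ-false {m} {n} m≰n with m ≤? n
... | yes m≤n = contradiction m≤n m≰n
... | no _ = refl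

𝟙 : {P : Set} → Dec P → ℤ
𝟙 d = if ⌊ d ⌋ then + 1 else + 0

𝟙-yes : ∀ {P} (d : Dec P) → P → 𝟙 d ≡ + 1
𝟙-yes (yes _) _ = refl
𝟙-yes (no ¬p) p = contradiction p ¬p

𝟙-no : ∀ {P} (d : Dec P) → ¬ P → 𝟙 d ≡ + 0
𝟙-no (yes p) ¬p = contradiction p ¬p
𝟙-no (no _) _ = refl

𝟙-cong : ∀ {P Q} (d : Dec P) (e : Dec Q) → (P → Q) → (Q → P) → 𝟙 d ≡ 𝟙 e
𝟙-cong (yes p) e to _ = sym (𝟙-yes e (to p))
𝟙-cong (no ¬p) e _ from = sym (𝟙-no e (λ q → ¬p (from q)))

𝟙-⊎ : ∀ {P Q S} (p : Dec P) (q : Dec Q) (s : Dec S) →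
  (P → Q ⊎ S) → (Q → P) → (S → P) → (Q → ¬ S) → 𝟙 p ≡ 𝟙 q +ℤ 𝟙 s
𝟙-⊎ (yes _) (yes q) (yes s) _ _ _ disjoint = contradiction s (disjoint q)
𝟙-⊎ (yes _) (yes _) (no _) _ _ _ _ = refl
𝟙-⊎ (yes _) (no _) (yes _) _ _ _ _ = refl
𝟙-⊎ (yes p) (no ¬q) (no ¬s) split _ _ _ with split p
... | inj₁ q = contradiction q ¬q
... | inj₂ s = contradiction s ¬s
𝟙-⊎ (no ¬p) (yes q) _ _ from-q _ _ = contradiction (from-q q) ¬p
𝟙-⊎ (no ¬p) (no _) (yes s) _ _ from-s _ = contradiction (from-s s) ¬p
𝟙-⊎ (no _) (no _) (no _) _ _ _ _ = refl

⌊⌋-∧ : ∀ {P Q : Set} (d : Dec P) (e : Dec Q) → ⌊ d ⌋ ∧ ⌊ e ⌋ ≡ ⌊ d ×-dec e ⌋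
⌊⌋-∧ (yes _) (yes _) = refl
⌊⌋-∧ (yes _) (no _) = refl
⌊⌋-∧ (no _) _ = refl

𝟙-if : ∀ {P Q : Set} (d : Dec P) (e : Dec Q) → (P → ¬ Q) →
  (if ⌊ d ⌋ then + 1 else if ⌊ e ⌋ then - (+ 1) else + 0) ≡ 𝟙 d -ℤ 𝟙 e
𝟙-if (yes p) e p⇒¬q = sym (cong (+ 1 -ℤ_) (𝟙-no e (p⇒¬q p)))
𝟙-if (no _) (yes _) _ = refl
𝟙-if (no _) (no _) _ = refl

self-negating : ∀ x → x ≡ - x → x ≡ + 0
self-negating (+ zero) _ = refl
self-negating (+ suc n) ()
self-negating -[1+ n ] ()

∑< : ℕ → (ℕ → ℤ) → ℤ
∑< zero f = + 0
∑< (suc c) f = ∑< c f +ℤ f c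

∑<-cong : ∀ c {f g : ℕ → ℤ} → (∀ i → i < c → f i ≡ g i) → ∑< c f ≡ ∑< c g
∑<-cong zero f≡g = refl
∑<-cong (suc c) f≡g = cong₂ _+ℤ_ (∑<-cong c (λ i i<c → f≡g i (ℕₚ.m<n⇒m<1+n i<c))) (f≡g c ℕₚ.≤-refl)

∑<-zero : ∀ c {f : ℕ → ℤ} → (∀ i → i < c → f i ≡ + 0) → ∑< c f ≡ + 0
∑<-zero zero f≡0 = refl
∑<-zero (suc c) f≡0 = cong₂ _+ℤ_ (∑<-zero c (λ i i<c → f≡0 i (ℕₚ.m<n⇒m<1+n i<c))) (f≡0 c ℕₚ.≤-refl)

∑<-single : ∀ c {f : ℕ → ℤ} j → j < c → (∀ i → i < c → i ≢ j → f i ≡ + 0) → ∑< c f ≡ f j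
∑<-single (suc c) {f} j j<1+c f≡0 with j ≟ c
... | yes refl = trans (cong (_+ℤ f c) (∑<-zero c (λ i i<c → f≡0 i (ℕₚ.m<n⇒m<1+n i<c) (ℕₚ.<⇒≢ i<c))))
                       (ℤₚ.+-identityˡ (f c))
... | no j≢c = trans (cong₂ _+ℤ_ (∑<-single c j (ℕₚ.≤∧≢⇒< (ℕₚ.≤-pred j<1+c) j≢c)
                                   (λ i i<c → f≡0 i (ℕₚ.m<n⇒m<1+n i<c)))
                                 (f≡0 c ℕₚ.≤-refl (≢-sym j≢c)))
                     (ℤₚ.+-identityʳ (f j))

∑<-+ : ∀ c (f g : ℕ → ℤ) → ∑< c (λ i → f i +ℤ g i) ≡ ∑< c f +ℤ ∑< c g
∑<-+ zero f g = refl
∑<-+ (suc c) f g = trans (cong (_+ℤ (f c +ℤ g c)) (∑<-+ c f g)) (interchange (∑< c f) (∑< c g) (f c) (g c))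
  where
  interchange : ∀ a b x y → (a +ℤ b) +ℤ (x +ℤ y) ≡ (a +ℤ x) +ℤ (b +ℤ y)
  interchange = solve-∀

∑<-select : ∀ c j (v : ℕ → ℤ) → j < c → ∑< c (λ i → 𝟙 (i ≟ j) *ℤ v i) ≡ v j
∑<-select c j v j<c =
  trans (∑<-single c j j<c (λ i _ i≢j → trans (cong (_*ℤ v i) (𝟙-no (i ≟ j) i≢j)) (ℤₚ.*-zeroˡ (v i))))
        (trans (cong (_*ℤ v j) (𝟙-yes (j ≟ j) refl)) (ℤₚ.*-identityˡ (v j)))

∑<-split : ∀ c {f g h : ℕ → ℤ} (v : ℕ → ℤ) → (∀ i → i < c → f i ≡ g i +ℤ h i) →
  ∑< c (λ i → f i *ℤ v i) ≡ ∑< c (λ i → g i *ℤ v i) +ℤ ∑< c (λ i → h i *ℤ v i)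
∑<-split c {f} {g} {h} v f≡g+h =
  trans (∑<-cong c (λ i i<c → trans (cong (_*ℤ v i) (f≡g+h i i<c)) (ℤₚ.*-distribʳ-+ (v i) (g i) (h i))))
        (∑<-+ c (λ i → g i *ℤ v i) (λ i → h i *ℤ v i))

∑<-neg : ∀ c (f : ℕ → ℤ) → ∑< c (λ i → - f i) ≡ - ∑< c f
∑<-neg zero f = refl
∑<-neg (suc c) f = trans (cong (_+ℤ - f c) (∑<-neg c f)) (sym (ℤₚ.neg-distrib-+ (∑< c f) (f c)))

∑<-unrollˡ : ∀ c (f : ℕ → ℤ) → ∑< (suc c) f ≡ f 0 +ℤ ∑< c (λ i → f (suc i))
∑<-unrollˡ zero f = ℤₚ.+-comm (+ 0) (f 0)
∑<-unrollˡ (suc c) f = trans (cong (_+ℤ f (suc c)) (∑<-unrollˡ c f)) (ℤₚ.+-assoc (f 0) _ (f (suc c)))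

∑<-reverse : ∀ c (f : ℕ → ℤ) → ∑< c f ≡ ∑< c (λ i → f (c ∸ suc i))
∑<-reverse zero f = refl
∑<-reverse (suc c) f = begin
  ∑< c f +ℤ f c                              ≡⟨ cong (_+ℤ f c) (∑<-reverse c f) ⟩
  ∑< c (λ i → f (c ∸ suc i)) +ℤ f c          ≡⟨ ℤₚ.+-comm _ (f c) ⟩
  f c +ℤ ∑< c (λ i → f (c ∸ suc i))          ≡⟨ ∑<-unrollˡ c (λ i → f (suc c ∸ suc i)) ⟨
  ∑< (suc c) (λ i → f (suc c ∸ suc i))       ∎
  where open ≡-Reasoning

∑<-𝟙 : ∀ c j {Q : Set} (q : Dec Q) → ∑< c (λ i → 𝟙 ((i ≟ j) ×-dec q)) ≡ 𝟙 ((j <? c) ×-dec q)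
∑<-𝟙 c j q with j <? c
... | yes j<c = trans (∑<-single c j j<c (λ i _ i≢j → 𝟙-no ((i ≟ j) ×-dec q) (λ (i≡j , _) → i≢j i≡j)))
                      (𝟙-cong ((j ≟ j) ×-dec q) ((yes j<c) ×-dec q) (λ (_ , q) → j<c , q) (λ (_ , q) → refl , q))
... | no j≮c = ∑<-zero c (λ i i<c → 𝟙-no ((i ≟ j) ×-dec q) (λ { (refl , _) → j≮c i<c }))

∑-cong : ∀ {n} {f g : Fin n → ℤ} → (∀ l → f l ≡ g l) → ∑ f ≡ ∑ g
∑-cong {zero} f≡g = refl
∑-cong {suc n} f≡g = cong₂ _+ℤ_ (f≡g Fin.zero) (∑-cong (λ l → f≡g (Fin.suc l)))

∑-zero : ∀ {n} (f : Fin n → ℤ) → (∀ l → f l ≡ + 0) → ∑ f ≡ + 0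
∑-zero {zero} f f≡0 = refl
∑-zero {suc n} f f≡0 = cong₂ _+ℤ_ (f≡0 Fin.zero) (∑-zero (λ l → f (Fin.suc l)) (λ l → f≡0 (Fin.suc l)))

∑-single : ∀ {n} (f : Fin n → ℤ) j → (∀ l → toℕ l ≢ toℕ j → f l ≡ + 0) → ∑ f ≡ f j
∑-single {suc n} f Fin.zero f≡0 =
  trans (cong (f Fin.zero +ℤ_) (∑-zero (λ l → f (Fin.suc l)) (λ l → f≡0 (Fin.suc l) (λ ()))))
        (ℤₚ.+-identityʳ _)
∑-single {suc n} f (Fin.suc j) f≡0 =
  trans (cong₂ _+ℤ_ (f≡0 Fin.zero (λ ()))
                    (∑-single (λ l → f (Fin.suc l)) j (λ l l≢j → f≡0 (Fin.suc l) (λ e → l≢j (ℕₚ.suc-injective e)))))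
        (ℤₚ.+-identityˡ _)

n∸1<n : ∀ {n} → 0 < n → n ∸ 1 < n
n∸1<n {suc n} _ = ℕₚ.≤-refl

suc[n∸1]≡n : ∀ {n} → 0 < n → suc (n ∸ 1) ≡ n
suc[n∸1]≡n {suc n} _ = refl

at-inside : ∀ {n} (M : Mat n) x y (x<n : x < n) (y<n : y < n) → at M x y ≡ M (fromℕ< x<n) (fromℕ< y<n)
at-inside {n} M x y x<n y<n with x <? n | y <? n
... | yes _ | yes _ = refl
... | no x≮n | _ = contradiction x<n x≮n
... | yes _ | no y≮n = contradiction y<n y≮n

at-outsideˡ : ∀ {n} (M : Mat n) x y → ¬ x < n → at M x y ≡ + 0
at-outsideˡ {n} M x y x≮n with x <? n | y <? n
... | yes x<n | yes _ = contradiction x<n x≮n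
... | no _ | _ = refl
... | yes _ | no _ = refl

at-outsideʳ : ∀ {n} (M : Mat n) x y → ¬ y < n → at M x y ≡ + 0
at-outsideʳ {n} M x y y≮n with x <? n | y <? n
... | yes _ | yes y<n = contradiction y<n y≮n
... | no _ | _ = refl
... | yes _ | no _ = refl

at-toℕ : ∀ {n} (M : Mat n) a b → at M (toℕ a) (toℕ b) ≡ M a b
at-toℕ M a b = trans (at-inside M (toℕ a) (toℕ b) (toℕ<n a) (toℕ<n b))
                     (cong₂ M (fromℕ<-toℕ a _) (fromℕ<-toℕ b _))

at-entrywise : ∀ {n} {A : Mat n} {B : Mat n} → (∀ x y → x < n → y < n → at A x y ≡ at B x y) → A ≈ₘ B
at-entrywise {A = A} {B} A≡B a b = trans (sym (at-toℕ A a b)) (trans (A≡B _ _ (toℕ<n a) (toℕ<n b)) (at-toℕ B a b))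

at-+ₘ : ∀ {n} (A B : Mat n) x y → x < n → y < n → at (A +ₘ B) x y ≡ at A x y +ℤ at B x y
at-+ₘ A B x y x<n y<n = trans (at-inside (A +ₘ B) x y x<n y<n)
                              (sym (cong₂ _+ℤ_ (at-inside A x y x<n y<n) (at-inside B x y x<n y<n)))

at-·ₘ : ∀ {n} c (A : Mat n) x y → x < n → y < n → at (c ·ₘ A) x y ≡ c *ℤ at A x y
at-·ₘ c A x y x<n y<n = trans (at-inside (c ·ₘ A) x y x<n y<n) (sym (cong (c *ℤ_) (at-inside A x y x<n y<n)))

at-sumMat0 : ∀ {n} c (F : ℕ → Mat n) x y → x < n → y < n → at (sumMat0 c F) x y ≡ ∑< c (λ i → at (F i) x y)
at-sumMat0 zero F x y x<n y<n = at-inside 0ₘ x y x<n y<n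
at-sumMat0 (suc c) F x y x<n y<n =
  trans (at-+ₘ (sumMat0 c F) (F c) x y x<n y<n) (cong (_+ℤ at (F c) x y) (at-sumMat0 c F x y x<n y<n))

at-idₘ : ∀ {n} x y → x < n → y < n → at (idₘ {n}) x y ≡ 𝟙 (x ≟ y)
at-idₘ {n} x y x<n y<n = trans (at-inside (idₘ {n}) x y x<n y<n) (cong₂ (λ a b → 𝟙 (a ≟ b)) (toℕ-fromℕ< x<n) (toℕ-fromℕ< y<n))

at-transpose : ∀ {n} (A : Mat n) x y → x < n → y < n → at (transpose A) x y ≡ at A y x
at-transpose A x y x<n y<n = trans (at-inside (transpose A) x y x<n y<n) (sym (at-inside A y x y<n x<n))

at-*ₘ : ∀ {n} (A B : Mat n) x y → x < n → y < n →
  at (A *ₘ B) x y ≡ ∑ {n} (λ l → at A x (toℕ l) *ℤ at B (toℕ l) y)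
at-*ₘ A B x y x<n y<n = trans (at-inside (A *ₘ B) x y x<n y<n) (∑-cong term)
  where
  term : ∀ l → A (fromℕ< x<n) l *ℤ B l (fromℕ< y<n) ≡ at A x (toℕ l) *ℤ at B (toℕ l) y
  term l = sym (cong₂ _*ℤ_ (trans (at-inside A x (toℕ l) x<n (toℕ<n l)) (cong (A _) (fromℕ<-toℕ l _)))
                           (trans (at-inside B (toℕ l) y (toℕ<n l) y<n) (cong (λ w → B w _) (fromℕ<-toℕ l _))))

at-*ₘ-single : ∀ {n} (A B : Mat n) x y z → x < n → y < n → z < n →
  (∀ l → l < n → l ≢ z → at A x l *ℤ at B l y ≡ + 0) → at (A *ₘ B) x y ≡ at A x z *ℤ at B z y
at-*ₘ-single {n} A B x y z x<n y<n z<n off-z = begin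
  at (A *ₘ B) x y                                         ≡⟨ at-*ₘ A B x y x<n y<n ⟩
  ∑ {n} (λ l → at A x (toℕ l) *ℤ at B (toℕ l) y)          ≡⟨ ∑-single _ (fromℕ< z<n) off-z′ ⟩
  at A x (toℕ (fromℕ< z<n)) *ℤ at B (toℕ (fromℕ< z<n)) y  ≡⟨ cong (λ w → at A x w *ℤ at B w y) (toℕ-fromℕ< z<n) ⟩
  at A x z *ℤ at B z y                                    ∎
  where
  open ≡-Reasoning
  off-z′ : ∀ l → toℕ l ≢ toℕ (fromℕ< z<n) → at A x (toℕ l) *ℤ at B (toℕ l) y ≡ + 0
  off-z′ l l≢z = off-z (toℕ l) (toℕ<n l) (λ e → l≢z (trans e (sym (toℕ-fromℕ< z<n))))

at-*ₘ-singleˡ : ∀ {n} (A B : Mat n) x y z → x < n → y < n → z < n →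
  (∀ l → l < n → l ≢ z → at A x l ≡ + 0) → at (A *ₘ B) x y ≡ at A x z *ℤ at B z y
at-*ₘ-singleˡ A B x y z x<n y<n z<n A≡0 =
  at-*ₘ-single A B x y z x<n y<n z<n (λ l l<n l≢z → trans (cong (_*ℤ at B l y) (A≡0 l l<n l≢z)) (ℤₚ.*-zeroˡ (at B l y)))

at-*ₘ-singleʳ : ∀ {n} (A B : Mat n) x y z → x < n → y < n → z < n →
  (∀ l → l < n → l ≢ z → at B l y ≡ + 0) → at (A *ₘ B) x y ≡ at A x z *ℤ at B z y
at-*ₘ-singleʳ A B x y z x<n y<n z<n B≡0 =
  at-*ₘ-single A B x y z x<n y<n z<n (λ l l<n l≢z → trans (cong (at A x l *ℤ_) (B≡0 l l<n l≢z)) (ℤₚ.*-zeroʳ (at A x l)))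

at-skew : ∀ {n} {M : Mat n} → SkewSymmetric M → ∀ x y → at M x y ≡ - at M y x
at-skew {n} {M} skew x y = by-range (x <? n) (y <? n)
  where
  by-range : Dec (x < n) → Dec (y < n) → at M x y ≡ - at M y x
  by-range (yes x<n) (yes y<n) = trans (at-inside M x y x<n y<n) (trans (skew _ _) (cong -_ (sym (at-inside M y x y<n x<n))))
  by-range (no x≮n) _ = trans (at-outsideˡ M x y x≮n) (cong -_ (sym (at-outsideʳ M y x x≮n)))
  by-range (yes _) (no y≮n) = trans (at-outsideʳ M x y y≮n) (cong -_ (sym (at-outsideˡ M y x y≮n)))

sumMat0-skew : ∀ {n} c (F : ℕ → Mat n) → (∀ i → i < c → SkewSymmetric (F i)) → SkewSymmetric (sumMat0 c F)
sumMat0-skew zero F _ a b = refl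
sumMat0-skew (suc c) F skew a b =
  trans (cong₂ _+ℤ_ (sumMat0-skew c F (λ i i<c → skew i (ℕₚ.m<n⇒m<1+n i<c)) a b) (skew c ℕₚ.≤-refl a b))
        (sym (ℤₚ.neg-distrib-+ (sumMat0 c F b a) (F c b a)))

+ₘ-skew : ∀ {n} {A B : Mat n} → SkewSymmetric A → SkewSymmetric B → SkewSymmetric (A +ₘ B)
+ₘ-skew {A = A} {B} skewA skewB a b =
  trans (cong₂ _+ℤ_ (skewA a b) (skewB a b)) (sym (ℤₚ.neg-distrib-+ (A b a) (B b a)))

·ₘ-skew : ∀ {n} c {A : Mat n} → SkewSymmetric A → SkewSymmetric (c ·ₘ A)
·ₘ-skew c {A} skew a b = trans (cong (c *ℤ_) (skew a b)) (sym (ℤₚ.neg-distribʳ-* c (A b a)))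

-- Signed cyclic shifts

record IsSignedCycle {n} (c : ℤ) (M : Mat n) : Set where
  field
    subdiagonal : ∀ l → suc l < n → at M (suc l) l ≡ + 1
    corner      : 0 < n → at M 0 (n ∸ 1) ≡ c
    elsewhere   : ∀ x l → x < n → l < n → x ≢ suc l → (x ≡ 0 → suc l ≢ n) → at M x l ≡ + 0

module SignedCycle {n} {c : ℤ} {M : Mat n} (cycle : IsSignedCycle c M) where
  open IsSignedCycle cycle

  *ₘ-suc : ∀ (X : Mat n) x y → suc x < n → y < n → at (M *ₘ X) (suc x) y ≡ at X x y
  *ₘ-suc X x y sx<n y<n =
    trans (at-*ₘ-singleˡ M X (suc x) y x sx<n y<n (ℕₚ.<⇒≤ sx<n)
            (λ l l<n l≢x → elsewhere (suc x) l sx<n l<n (λ e → l≢x (ℕₚ.suc-injective (sym e))) (λ ())))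
          (trans (cong (_*ℤ at X x y) (subdiagonal x sx<n)) (ℤₚ.*-identityˡ _))

  *ₘ-zero : ∀ (X : Mat n) y → 0 < n → y < n → at (M *ₘ X) 0 y ≡ c *ℤ at X (n ∸ 1) y
  *ₘ-zero X y 0<n y<n =
    trans (at-*ₘ-singleˡ M X 0 y (n ∸ 1) 0<n y<n (n∸1<n 0<n)
            (λ l l<n l≢n∸1 → elsewhere 0 l 0<n l<n (λ ()) (λ _ e → l≢n∸1 (cong (_∸ 1) e))))
          (cong (_*ℤ at X (n ∸ 1) y) (corner 0<n))

  ᵀ*ₘ-pred : ∀ (Y : Mat n) x y → suc x < n → y < n → at (transpose M *ₘ Y) x y ≡ at Y (suc x) y
  ᵀ*ₘ-pred Y x y sx<n y<n =
    trans (at-*ₘ-singleˡ (transpose M) Y x y (suc x) x<n y<n sx<n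
            (λ l l<n l≢sx → trans (at-transpose M x l x<n l<n)
                                  (elsewhere l x l<n x<n l≢sx (λ _ e → ℕₚ.<-irrefl e sx<n))))
          (trans (cong (_*ℤ at Y (suc x) y) (trans (at-transpose M x (suc x) x<n sx<n) (subdiagonal x sx<n)))
                 (ℤₚ.*-identityˡ _))
    where x<n = ℕₚ.<⇒≤ sx<n

  ᵀ*ₘ-last : ∀ (Y : Mat n) y → 0 < n → y < n → at (transpose M *ₘ Y) (n ∸ 1) y ≡ c *ℤ at Y 0 y
  ᵀ*ₘ-last Y y 0<n y<n =
    trans (at-*ₘ-singleˡ (transpose M) Y (n ∸ 1) y 0 (n∸1<n 0<n) y<n 0<n
            (λ l l<n l≢0 → trans (at-transpose M (n ∸ 1) l (n∸1<n 0<n) l<n)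
                                 (elsewhere l (n ∸ 1) l<n (n∸1<n 0<n) (below-n l l<n) (λ l≡0 → contradiction l≡0 l≢0))))
          (cong (_*ℤ at Y 0 y) (trans (at-transpose M (n ∸ 1) 0 (n∸1<n 0<n) 0<n) (corner 0<n)))
    where
    below-n : ∀ l → l < n → l ≢ suc (n ∸ 1)
    below-n l l<n e = ℕₚ.<-irrefl (trans e (suc[n∸1]≡n 0<n)) l<n

  *ₘᵀ-suc : ∀ (X : Mat n) x y → x < n → suc y < n → at (X *ₘ transpose M) x (suc y) ≡ at X x y
  *ₘᵀ-suc X x y x<n sy<n =
    trans (at-*ₘ-singleʳ X (transpose M) x (suc y) y x<n sy<n (ℕₚ.<⇒≤ sy<n)
            (λ l l<n l≢y → trans (at-transpose M l (suc y) l<n sy<n)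
                                 (elsewhere (suc y) l sy<n l<n (λ e → l≢y (ℕₚ.suc-injective (sym e))) (λ ()))))
          (trans (cong (at X x y *ℤ_) (trans (at-transpose M y (suc y) (ℕₚ.<⇒≤ sy<n) sy<n) (subdiagonal y sy<n)))
                 (ℤₚ.*-identityʳ _))

at-ρ : ∀ {n} x l (x<n : x < n) (l<n : l < n) → at (ρ {n}) x l ≡
  (if ((suc x == suc (suc l)) ∧ (suc l ≤ᵇ (n ∸ 1))) ∨ ((suc x == 1) ∧ (suc l == n)) then + 1 else + 0)
at-ρ x l x<n l<n rewrite at-inside ρ x l x<n l<n | toℕ-fromℕ< x<n | toℕ-fromℕ< l<n = refl

ρ-isSignedCycle : ∀ {n} → IsSignedCycle (+ 1) (ρ {n})
ρ-isSignedCycle {n} = record { subdiagonal = subdiagonal ; corner = corner ; elsewhere = elsewhere }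
  where
  subdiagonal : ∀ l → suc l < n → at (ρ {n}) (suc l) l ≡ + 1
  subdiagonal l sl<n rewrite at-ρ (suc l) l sl<n (ℕₚ.<⇒≤ sl<n) | ==-true {suc (suc l)} refl
    | ≤ᵇ-true (ℕₚ.∸-monoˡ-≤ 1 sl<n) = refl
  corner : 0 < n → at (ρ {n}) 0 (n ∸ 1) ≡ + 1
  corner 0<n rewrite at-ρ 0 (n ∸ 1) 0<n (n∸1<n 0<n) | ==-false {1} {suc (suc (n ∸ 1))} (λ ())
    | ==-true (suc[n∸1]≡n 0<n) = refl
  elsewhere : ∀ x l → x < n → l < n → x ≢ suc l → (x ≡ 0 → suc l ≢ n) → at (ρ {n}) x l ≡ + 0
  elsewhere x l x<n l<n x≢sl corner≢ rewrite at-ρ x l x<n l<n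
    | ==-false {suc x} {suc (suc l)} (λ e → x≢sl (ℕₚ.suc-injective e)) with x
  ... | zero rewrite ==-false (corner≢ refl) = refl
  ... | suc _ = refl

at-τ : ∀ {n} x l (x<n : x < n) (l<n : l < n) → at (τ {n}) x l ≡
  (if (suc x == suc (suc l)) ∧ (suc l ≤ᵇ (n ∸ 1)) then + 1
   else if (suc x == 1) ∧ (suc l == n) then - (+ 1) else + 0)
at-τ x l x<n l<n rewrite at-inside τ x l x<n l<n | toℕ-fromℕ< x<n | toℕ-fromℕ< l<n = refl

τ-isSignedCycle : ∀ {n} → IsSignedCycle (- (+ 1)) (τ {n})
τ-isSignedCycle {n} = record { subdiagonal = subdiagonal ; corner = corner ; elsewhere = elsewhere }
  where
  subdiagonal : ∀ l → suc l < n → at (τ {n}) (suc l) l ≡ + 1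
  subdiagonal l sl<n rewrite at-τ (suc l) l sl<n (ℕₚ.<⇒≤ sl<n) | ==-true {suc (suc l)} refl
    | ≤ᵇ-true (ℕₚ.∸-monoˡ-≤ 1 sl<n) = refl
  corner : 0 < n → at (τ {n}) 0 (n ∸ 1) ≡ - (+ 1)
  corner 0<n rewrite at-τ 0 (n ∸ 1) 0<n (n∸1<n 0<n) | ==-false {1} {suc (suc (n ∸ 1))} (λ ())
    | ==-true (suc[n∸1]≡n 0<n) = refl
  elsewhere : ∀ x l → x < n → l < n → x ≢ suc l → (x ≡ 0 → suc l ≢ n) → at (τ {n}) x l ≡ + 0
  elsewhere x l x<n l<n x≢sl corner≢ rewrite at-τ x l x<n l<n
    | ==-false {suc x} {suc (suc l)} (λ e → x≢sl (ℕₚ.suc-injective e)) with x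
  ... | zero rewrite ==-false (corner≢ refl) = refl
  ... | suc _ = refl

shiftEntry : ℕ → ℕ → ℕ → ℕ → ℤ
shiftEntry n i x l = 𝟙 (x ≟ l + i) -ℤ 𝟙 (x + n ≟ l + i)

module _ {n : ℕ} where
  open SignedCycle (τ-isSignedCycle {n})

  private
    wrap-sign : ∀ a → - (+ 1) *ℤ (a -ℤ + 0) ≡ + 0 -ℤ a
    wrap-sign = solve-∀

  τ^-entry : ∀ i x l → i ≤ n → x < n → l < n → at (τ {n} ^ₘ i) x l ≡ shiftEntry n i x l
  τ^-entry zero x l _ x<n l<n = begin
    at (idₘ {n}) x l                      ≡⟨ at-idₘ x l x<n l<n ⟩
    𝟙 (x ≟ l)                             ≡⟨ 𝟙-cong (x ≟ l) (x ≟ l + 0) (λ e → trans e (sym (ℕₚ.+-identityʳ l)))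
                                                                         (λ e → trans e (ℕₚ.+-identityʳ l)) ⟩
    𝟙 (x ≟ l + 0)                         ≡⟨ ℤₚ.+-identityʳ _ ⟨
    𝟙 (x ≟ l + 0) -ℤ + 0                  ≡⟨ cong (𝟙 (x ≟ l + 0) -ℤ_) (𝟙-no (x + n ≟ l + 0) no-wrap) ⟨
    shiftEntry n 0 x l                    ∎
    where
    open ≡-Reasoning
    no-wrap : x + n ≢ l + 0
    no-wrap e = ℕₚ.<-irrefl (trans (sym (ℕₚ.+-identityʳ l)) (sym e)) (ℕₚ.<-≤-trans l<n (ℕₚ.m≤n+m n x))
  τ^-entry (suc i) (suc x) l 1+i≤n sx<n l<n = begin
    at (τ {n} *ₘ (τ ^ₘ i)) (suc x) l      ≡⟨ *ₘ-suc (τ ^ₘ i) x l sx<n l<n ⟩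
    at (τ {n} ^ₘ i) x l                   ≡⟨ τ^-entry i x l (ℕₚ.<⇒≤ 1+i≤n) (ℕₚ.<⇒≤ sx<n) l<n ⟩
    shiftEntry n i x l                    ≡⟨ cong₂ _-ℤ_ (𝟙-cong (x ≟ l + i) (suc x ≟ l + suc i) (≡+-suc x) (≡+-suc⁻¹ x))
                                                        (𝟙-cong (x + n ≟ l + i) (suc x + n ≟ l + suc i) (≡+-suc (x + n)) (≡+-suc⁻¹ (x + n))) ⟩
    shiftEntry n (suc i) (suc x) l        ∎
    where
    open ≡-Reasoning
    ≡+-suc : ∀ a → a ≡ l + i → suc a ≡ l + suc i
    ≡+-suc a e = trans (cong suc e) (sym (ℕₚ.+-suc l i))
    ≡+-suc⁻¹ : ∀ a → suc a ≡ l + suc i → a ≡ l + i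
    ≡+-suc⁻¹ a e = ℕₚ.suc-injective (trans e (ℕₚ.+-suc l i))
  τ^-entry (suc i) zero l 1+i≤n 0<n l<n = begin
    at (τ {n} *ₘ (τ ^ₘ i)) 0 l                          ≡⟨ *ₘ-zero (τ ^ₘ i) l 0<n l<n ⟩
    - (+ 1) *ℤ at (τ {n} ^ₘ i) (n ∸ 1) l                ≡⟨ cong (- (+ 1) *ℤ_) (τ^-entry i (n ∸ 1) l (ℕₚ.<⇒≤ 1+i≤n) (n∸1<n 0<n) l<n) ⟩
    - (+ 1) *ℤ shiftEntry n i (n ∸ 1) l                 ≡⟨ cong₂ (λ a b → - (+ 1) *ℤ (a -ℤ b))
                                                                 (𝟙-cong (n ∸ 1 ≟ l + i) (n ≟ l + suc i) last→ →last)
                                                                 (𝟙-no (n ∸ 1 + n ≟ l + i) too-big) ⟩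
    - (+ 1) *ℤ (𝟙 (n ≟ l + suc i) -ℤ + 0)               ≡⟨ wrap-sign (𝟙 (n ≟ l + suc i)) ⟩
    + 0 -ℤ 𝟙 (n ≟ l + suc i)                            ≡⟨ cong (_-ℤ 𝟙 (n ≟ l + suc i)) (𝟙-no (0 ≟ l + suc i) 0≢) ⟨
    shiftEntry n (suc i) 0 l                            ∎
    where
    open ≡-Reasoning
    last→ : n ∸ 1 ≡ l + i → n ≡ l + suc i
    last→ e = trans (sym (suc[n∸1]≡n 0<n)) (trans (cong suc e) (sym (ℕₚ.+-suc l i)))
    →last : n ≡ l + suc i → n ∸ 1 ≡ l + i
    →last e = cong (_∸ 1) (trans e (ℕₚ.+-suc l i))
    too-big : n ∸ 1 + n ≢ l + i
    too-big e = ℕₚ.<-irrefl (sym e) (ℕₚ.+-mono-≤-< (ℕₚ.∸-monoˡ-≤ 1 l<n) 1+i≤n)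
    0≢ : 0 ≢ l + suc i
    0≢ e = ℕₚ.0≢1+n (trans e (ℕₚ.+-suc l i))

  τ⁻¹^-entry : ∀ i x l → i ≤ n → x < n → l < n → at (τ⁻¹ {n} ^ₘ i) x l ≡ shiftEntry n i l x
  τ⁻¹^-entry zero x l _ x<n l<n = begin
    at (idₘ {n}) x l                      ≡⟨ at-idₘ x l x<n l<n ⟩
    𝟙 (x ≟ l)                             ≡⟨ 𝟙-cong (x ≟ l) (l ≟ x + 0) (λ e → trans (sym e) (sym (ℕₚ.+-identityʳ x)))
                                                                         (λ e → sym (trans e (ℕₚ.+-identityʳ x))) ⟩
    𝟙 (l ≟ x + 0)                         ≡⟨ ℤₚ.+-identityʳ _ ⟨
    𝟙 (l ≟ x + 0) -ℤ + 0                  ≡⟨ cong (𝟙 (l ≟ x + 0) -ℤ_) (𝟙-no (l + n ≟ x + 0) no-wrap) ⟨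
    shiftEntry n 0 l x                    ∎
    where
    open ≡-Reasoning
    no-wrap : l + n ≢ x + 0
    no-wrap e = ℕₚ.<-irrefl (trans (sym (ℕₚ.+-identityʳ x)) (sym e)) (ℕₚ.<-≤-trans x<n (ℕₚ.m≤n+m n l))
  τ⁻¹^-entry (suc i) x l 1+i≤n x<n l<n with suc x <? n
  ... | yes sx<n = begin
    at (τ⁻¹ {n} *ₘ (τ⁻¹ ^ₘ i)) x l        ≡⟨ ᵀ*ₘ-pred (τ⁻¹ ^ₘ i) x l sx<n l<n ⟩
    at (τ⁻¹ {n} ^ₘ i) (suc x) l           ≡⟨ τ⁻¹^-entry i (suc x) l (ℕₚ.<⇒≤ 1+i≤n) sx<n l<n ⟩
    shiftEntry n i l (suc x)              ≡⟨ cong (λ w → 𝟙 (l ≟ w) -ℤ 𝟙 (l + n ≟ w)) (ℕₚ.+-suc x i) ⟨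
    shiftEntry n (suc i) l x              ∎
    where open ≡-Reasoning
  ... | no sx≮n = subst (λ x → at (τ⁻¹ {n} ^ₘ suc i) x l ≡ shiftEntry n (suc i) l x) (sym x≡n∸1) last-row
    where
    open ≡-Reasoning
    x≡n∸1 : x ≡ n ∸ 1
    x≡n∸1 = cong (_∸ 1) (ℕₚ.≤-antisym x<n (ℕₚ.≮⇒≥ sx≮n))
    0<n : 0 < n
    0<n = ℕₚ.<-≤-trans (s≤s z≤n) l<n
    wraps : l ≡ i → l + n ≡ n ∸ 1 + suc i
    wraps e = trans (cong (_+ n) e) (trans (ℕₚ.+-comm i n) (trans (cong (_+ i) (sym (suc[n∸1]≡n 0<n))) (sym (ℕₚ.+-suc (n ∸ 1) i))))
    wraps⁻¹ : l + n ≡ n ∸ 1 + suc i → l ≡ i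
    wraps⁻¹ e = ℕₚ.+-cancelʳ-≡ n l i (trans e (trans (ℕₚ.+-suc (n ∸ 1) i) (trans (cong (_+ i) (suc[n∸1]≡n 0<n)) (ℕₚ.+-comm n i))))
    last-row : at (τ⁻¹ {n} ^ₘ suc i) (n ∸ 1) l ≡ shiftEntry n (suc i) l (n ∸ 1)
    last-row = begin
      at (τ⁻¹ {n} *ₘ (τ⁻¹ ^ₘ i)) (n ∸ 1) l            ≡⟨ ᵀ*ₘ-last (τ⁻¹ ^ₘ i) l 0<n l<n ⟩
      - (+ 1) *ℤ at (τ⁻¹ {n} ^ₘ i) 0 l                ≡⟨ cong (- (+ 1) *ℤ_) (τ⁻¹^-entry i 0 l (ℕₚ.<⇒≤ 1+i≤n) 0<n l<n) ⟩
      - (+ 1) *ℤ shiftEntry n i l 0                   ≡⟨ cong₂ (λ a b → - (+ 1) *ℤ (a -ℤ b))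
                                                             (𝟙-cong (l ≟ i) (l + n ≟ n ∸ 1 + suc i) wraps wraps⁻¹)
                                                             (𝟙-no (l + n ≟ i) (λ e → ℕₚ.<-irrefl (sym e) (ℕₚ.<-≤-trans 1+i≤n (ℕₚ.m≤n+m n l)))) ⟩
      - (+ 1) *ℤ (𝟙 (l + n ≟ n ∸ 1 + suc i) -ℤ + 0)   ≡⟨ wrap-sign (𝟙 (l + n ≟ n ∸ 1 + suc i)) ⟩
      + 0 -ℤ 𝟙 (l + n ≟ n ∸ 1 + suc i)                ≡⟨ cong (_-ℤ 𝟙 (l + n ≟ n ∸ 1 + suc i)) (𝟙-no (l ≟ n ∸ 1 + suc i) too-small) ⟨
      shiftEntry n (suc i) l (n ∸ 1)                  ∎
      where
      too-small : l ≢ n ∸ 1 + suc i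
      too-small e = ℕₚ.<-irrefl e (ℕₚ.<-≤-trans l<n (ℕₚ.≤-trans (ℕₚ.≤-reflexive (sym (suc[n∸1]≡n 0<n)))
                                    (ℕₚ.≤-trans (s≤s (ℕₚ.m≤m+n (n ∸ 1) i)) (ℕₚ.≤-reflexive (sym (ℕₚ.+-suc (n ∸ 1) i))))))

-- Row or column x of τ^i W τ^(-i) is row or column `source` of W; wrapping around the corner of τ costs a sign.
data CyclicPreimage (n i x : ℕ) : Set where
  direct  : ∀ z → z + i ≡ x → CyclicPreimage n i x
  wrapped : ∀ z → x + n ≡ z + i → x < i → CyclicPreimage n i x

module _ {n i x : ℕ} where

  source : CyclicPreimage n i x → ℕ
  source (direct z _) = z
  source (wrapped z _ _) = z

  sign : CyclicPreimage n i x → ℤ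
  sign (direct _ _) = + 1
  sign (wrapped _ _ _) = - (+ 1)

  source<n : x < n → (v : CyclicPreimage n i x) → source v < n
  source<n x<n (direct z z+i≡x) = ℕₚ.≤-<-trans (ℕₚ.m≤m+n z i) (subst (_< n) (sym z+i≡x) x<n)
  source<n x<n (wrapped z x+n≡z+i x<i) =
    ℕₚ.+-cancelʳ-< i z n (subst (_< n + i) x+n≡z+i (subst (x + n <_) (ℕₚ.+-comm i n) (ℕₚ.+-monoˡ-< n x<i)))

  shiftEntry-source : x < n → (v : CyclicPreimage n i x) → shiftEntry n i x (source v) ≡ sign v
  shiftEntry-source x<n (direct z z+i≡x) =
    cong₂ _-ℤ_ (𝟙-yes (x ≟ z + i) (sym z+i≡x))
               (𝟙-no (x + n ≟ z + i) (λ e → ℕₚ.<-irrefl (sym (trans e z+i≡x)) (ℕₚ.m<m+n x (ℕₚ.≤-<-trans z≤n x<n))))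
  shiftEntry-source x<n (wrapped z x+n≡z+i x<i) =
    cong₂ _-ℤ_ (𝟙-no (x ≟ z + i) (λ e → ℕₚ.<-irrefl e (ℕₚ.<-≤-trans x<i (ℕₚ.m≤n+m i z)))) (𝟙-yes (x + n ≟ z + i) x+n≡z+i)

  shiftEntry-off : ∀ {l} → l < n → (v : CyclicPreimage n i x) → l ≢ source v → shiftEntry n i x l ≡ + 0
  shiftEntry-off {l} l<n (direct z z+i≡x) l≢z =
    cong₂ _-ℤ_ (𝟙-no (x ≟ l + i) (λ e → l≢z (ℕₚ.+-cancelʳ-≡ i l z (trans (sym e) (sym z+i≡x)))))
               (𝟙-no (x + n ≟ l + i) too-far)
    where
    too-far : x + n ≢ l + i
    too-far e = ℕₚ.<-irrefl (ℕₚ.+-cancelʳ-≡ i l (z + n) lz) (ℕₚ.<-≤-trans l<n (ℕₚ.m≤n+m n z))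
      where
      lz : l + i ≡ z + n + i
      lz = trans (sym e) (trans (cong (_+ n) (sym z+i≡x)) (trans (ℕₚ.+-assoc z i n)
             (trans (cong (λ w → z + w) (ℕₚ.+-comm i n)) (sym (ℕₚ.+-assoc z n i)))))
  shiftEntry-off {l} l<n (wrapped z x+n≡z+i x<i) l≢z =
    cong₂ _-ℤ_ (𝟙-no (x ≟ l + i) (λ e → ℕₚ.<-irrefl e (ℕₚ.<-≤-trans x<i (ℕₚ.m≤n+m i l))))
               (𝟙-no (x + n ≟ l + i) (λ e → l≢z (ℕₚ.+-cancelʳ-≡ i l z (trans (sym e) x+n≡z+i))))

cyclicPreimage : ∀ {n} i x → i ≤ n → CyclicPreimage n i x
cyclicPreimage {n} i x i≤n with i ≤? x
... | yes i≤x = direct (x ∸ i) (ℕₚ.m∸n+n≡m i≤x)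
... | no i≰x = wrapped (x + n ∸ i) (sym (ℕₚ.m∸n+n≡m (ℕₚ.≤-trans i≤n (ℕₚ.m≤n+m n x)))) (ℕₚ.≰⇒> i≰x)

module _ {n : ℕ} (W : Mat n) {i : ℕ} (i≤n : i ≤ n) where

  at-τ^-*ₘ : ∀ {x} y (v : CyclicPreimage n i x) → x < n → y < n → at ((τ ^ₘ i) *ₘ W) x y ≡ sign v *ℤ at W (source v) y
  at-τ^-*ₘ {x} y v x<n y<n =
    trans (at-*ₘ-singleˡ (τ ^ₘ i) W x y (source v) x<n y<n z<n
            (λ l l<n l≢z → trans (τ^-entry i x l i≤n x<n l<n) (shiftEntry-off l<n v l≢z)))
          (cong (_*ℤ at W (source v) y) (trans (τ^-entry i x (source v) i≤n x<n z<n) (shiftEntry-source x<n v)))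
    where z<n = source<n x<n v

  at-*ₘ-τ⁻¹^ : ∀ x {y} (v : CyclicPreimage n i y) → x < n → y < n → at (W *ₘ (τ⁻¹ ^ₘ i)) x y ≡ at W x (source v) *ℤ sign v
  at-*ₘ-τ⁻¹^ x {y} v x<n y<n =
    trans (at-*ₘ-singleʳ W (τ⁻¹ ^ₘ i) x y (source v) x<n y<n z<n
            (λ l l<n l≢z → trans (τ⁻¹^-entry i l y i≤n l<n y<n) (shiftEntry-off l<n v l≢z)))
          (cong (at W x (source v) *ℤ_) (trans (τ⁻¹^-entry i (source v) y i≤n z<n y<n) (shiftEntry-source y<n v)))
    where z<n = source<n y<n v

conj : ∀ {n} → ℕ → Mat n → Mat n
conj i W = (τ ^ₘ i) *ₘ (W *ₘ (τ⁻¹ ^ₘ i))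

at-conj : ∀ {n} (W : Mat n) {i x y} (vx : CyclicPreimage n i x) (vy : CyclicPreimage n i y) → i ≤ n → x < n → y < n →
  at (conj i W) x y ≡ sign vx *ℤ (at W (source vx) (source vy) *ℤ sign vy)
at-conj W {i} vx vy i≤n x<n y<n =
  trans (at-τ^-*ₘ (W *ₘ (τ⁻¹ ^ₘ i)) i≤n _ vx x<n y<n)
        (cong (sign vx *ℤ_) (at-*ₘ-τ⁻¹^ W i≤n _ vy (source<n x<n vx) y<n))

conj-skew : ∀ {n} {W : Mat n} i → i ≤ n → SkewSymmetric W → SkewSymmetric (conj i W)
conj-skew {n} {W} i i≤n skew a b = begin
  conj i W a b                                              ≡⟨ at-toℕ (conj i W) a b ⟨
  at (conj i W) x y                                         ≡⟨ at-conj W vx vy i≤n (toℕ<n a) (toℕ<n b) ⟩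
  sign vx *ℤ (at W (source vx) (source vy) *ℤ sign vy)      ≡⟨ cong (λ w → sign vx *ℤ (w *ℤ sign vy)) (at-skew skew _ _) ⟩
  sign vx *ℤ (- at W (source vy) (source vx) *ℤ sign vy)    ≡⟨ swap (sign vx) (sign vy) (at W (source vy) (source vx)) ⟩
  - (sign vy *ℤ (at W (source vy) (source vx) *ℤ sign vx))  ≡⟨ cong -_ (at-conj W vy vx i≤n (toℕ<n b) (toℕ<n a)) ⟨
  - at (conj i W) y x                                       ≡⟨ cong -_ (at-toℕ (conj i W) b a) ⟩
  - conj i W b a                                            ∎
  where
  open ≡-Reasoning
  x = toℕ a
  y = toℕ b
  vx = cyclicPreimage i x i≤n
  vy = cyclicPreimage i y i≤n
  swap : ∀ s t w → s *ℤ (- w *ℤ t) ≡ - (t *ℤ (w *ℤ s))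
  swap = solve-∀

-- The primitives B_n^(k)

suc≡+1 : ∀ {a m} → suc a ≡ m + 1 → a ≡ m
suc≡+1 {a} {m} e = ℕₚ.suc-injective (trans e (ℕₚ.+-comm m 1))

≡→suc≡+1 : ∀ {a m} → a ≡ m → suc a ≡ m + 1
≡→suc≡+1 {a} {m} e = trans (cong suc e) (ℕₚ.+-comm 1 m)

at-R : ∀ {n} k a b → k < n → a < n → b < n →
  at (R {n} k) a b ≡ 𝟙 ((a ≟ n ∸ k) ×-dec (b ≟ 0)) -ℤ 𝟙 ((a ≟ 0) ×-dec (b ≟ n ∸ k))
at-R {n} k a b k<n a<n b<n
  rewrite at-inside (R k) a b a<n b<n | toℕ-fromℕ< a<n | toℕ-fromℕ< b<n
        | ⌊⌋-∧ (suc a ≟ n ∸ k + 1) (suc b ≟ 1) | ⌊⌋-∧ (suc a ≟ 1) (suc b ≟ n ∸ k + 1)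
  = trans (𝟙-if ((suc a ≟ K + 1) ×-dec (suc b ≟ 1)) ((suc a ≟ 1) ×-dec (suc b ≟ K + 1)) exclusive)
          (cong₂ _-ℤ_ (𝟙-cong ((suc a ≟ K + 1) ×-dec (suc b ≟ 1)) ((a ≟ K) ×-dec (b ≟ 0))
                              (λ (p , q) → suc≡+1 p , ℕₚ.suc-injective q) (λ (p , q) → ≡→suc≡+1 p , cong suc q))
                      (𝟙-cong ((suc a ≟ 1) ×-dec (suc b ≟ K + 1)) ((a ≟ 0) ×-dec (b ≟ K))
                              (λ (p , q) → ℕₚ.suc-injective p , suc≡+1 q) (λ (p , q) → cong suc p , ≡→suc≡+1 q)))
  where
  K = n ∸ k
  exclusive : suc a ≡ K + 1 × suc b ≡ 1 → ¬ (suc a ≡ 1 × suc b ≡ K + 1)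
  exclusive (_ , b≡0) (_ , b≡K) =
    ℕₚ.<-irrefl (suc≡+1 (trans (sym b≡0) b≡K)) (ℕₚ.m<n⇒0<n∸m k<n)

R-skew : ∀ {n} k → k < n → SkewSymmetric (R {n} k)
R-skew {n} k k<n a b = begin
  R k a b                                                      ≡⟨ at-toℕ (R k) a b ⟨
  at (R {n} k) x y                                             ≡⟨ at-R k x y k<n (toℕ<n a) (toℕ<n b) ⟩
  𝟙 ((x ≟ K) ×-dec (y ≟ 0)) -ℤ 𝟙 ((x ≟ 0) ×-dec (y ≟ K))       ≡⟨ cong₂ _-ℤ_ (swap (x ≟ K) (y ≟ 0)) (swap (x ≟ 0) (y ≟ K)) ⟩
  𝟙 ((y ≟ 0) ×-dec (x ≟ K)) -ℤ 𝟙 ((y ≟ K) ×-dec (x ≟ 0))       ≡⟨ antisym (𝟙 ((y ≟ 0) ×-dec (x ≟ K))) (𝟙 ((y ≟ K) ×-dec (x ≟ 0))) ⟩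
  - (𝟙 ((y ≟ K) ×-dec (x ≟ 0)) -ℤ 𝟙 ((y ≟ 0) ×-dec (x ≟ K)))   ≡⟨ cong -_ (at-R k y x k<n (toℕ<n b) (toℕ<n a)) ⟨
  - at (R {n} k) y x                                           ≡⟨ cong -_ (at-toℕ (R k) b a) ⟩
  - R k b a                                                    ∎
  where
  open ≡-Reasoning
  x = toℕ a
  y = toℕ b
  K = n ∸ k
  swap : ∀ {P Q} (d : Dec P) (e : Dec Q) → 𝟙 (d ×-dec e) ≡ 𝟙 (e ×-dec d)
  swap d e = 𝟙-cong (d ×-dec e) (e ×-dec d) (λ (p , q) → q , p) (λ (q , p) → p , q)
  antisym : ∀ u v → u -ℤ v ≡ - (v -ℤ u)
  antisym = solve-∀

private
  module _ {n k : ℕ} (k<n : k < n) {i x y : ℕ} (i<n : i < n) (y<x : y < x) (x<n : x < n) where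
    private
      K = n ∸ k
      Rk : Mat n
      Rk = R k
      y<n = ℕₚ.<-trans y<x x<n
      i≤n = ℕₚ.<⇒≤ i<n
      k+K≡n : k + K ≡ n
      k+K≡n = ℕₚ.m+[n∸m]≡n (ℕₚ.<⇒≤ k<n)
      lowerEntry = 𝟙 ((i ≟ y) ×-dec (x ≟ y + K)) +ℤ 𝟙 ((i ≟ x) ×-dec (x ≟ y + k))

      wrapped≢0 : ∀ {a z} → a + n ≡ z + i → z ≢ 0
      wrapped≢0 {a} e refl = ℕₚ.<-irrefl (sym e) (ℕₚ.<-≤-trans i<n (ℕₚ.m≤n+m n a))

      cancel : ∀ {a b} → a + i ≡ b + i → a ≡ b
      cancel {a} {b} = ℕₚ.+-cancelʳ-≡ i a b

    at-conj-R-direct : ∀ zx zy → zx + i ≡ x → zy + i ≡ y → at (conj i Rk) x y ≡ lowerEntry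
    at-conj-R-direct zx zy ex ey = begin
      at (conj i Rk) x y                                        ≡⟨ at-conj Rk vx vy i≤n x<n y<n ⟩
      + 1 *ℤ (at Rk zx zy *ℤ + 1)                               ≡⟨ trans (ℤₚ.*-identityˡ _) (ℤₚ.*-identityʳ _) ⟩
      at Rk zx zy                                               ≡⟨ at-R k zx zy k<n (source<n x<n vx) (source<n y<n vy) ⟩
      𝟙 ((zx ≟ K) ×-dec (zy ≟ 0)) -ℤ 𝟙 ((zx ≟ 0) ×-dec (zy ≟ K))
          ≡⟨ cong₂ _-ℤ_ (𝟙-cong ((zx ≟ K) ×-dec (zy ≟ 0)) ((i ≟ y) ×-dec (x ≟ y + K)) to from)
                        (𝟙-no ((zx ≟ 0) ×-dec (zy ≟ K)) (λ (zx≡0 , _) → i≢x (trans (cong (_+ i) (sym zx≡0)) ex))) ⟩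
      𝟙 ((i ≟ y) ×-dec (x ≟ y + K)) +ℤ + 0
          ≡⟨ cong (𝟙 ((i ≟ y) ×-dec (x ≟ y + K)) +ℤ_) (𝟙-no ((i ≟ x) ×-dec (x ≟ y + k)) (λ (i≡x , _) → i≢x i≡x)) ⟨
      lowerEntry                                                   ∎
      where
      open ≡-Reasoning
      vx = direct {n} zx ex
      vy = direct {n} zy ey
      i≢x : i ≢ x
      i≢x i≡x = ℕₚ.<-irrefl i≡x (ℕₚ.≤-<-trans (subst (i ≤_) ey (ℕₚ.m≤n+m i zy)) y<x)
      to : zx ≡ K × zy ≡ 0 → i ≡ y × x ≡ y + K
      to (refl , refl) = ey , trans (sym ex) (trans (ℕₚ.+-comm K i) (cong (_+ K) ey))
      from : i ≡ y × x ≡ y + K → zx ≡ K × zy ≡ 0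
      from (refl , x≡i+K) = cancel (trans ex (trans x≡i+K (ℕₚ.+-comm i K))) , cancel ey

    at-conj-R-mixed : ∀ zx zy → zx + i ≡ x → y + n ≡ zy + i → y < i → at (conj i Rk) x y ≡ lowerEntry
    at-conj-R-mixed zx zy ex ey y<i = begin
      at (conj i Rk) x y                                           ≡⟨ at-conj Rk vx vy i≤n x<n y<n ⟩
      + 1 *ℤ (at Rk zx zy *ℤ - (+ 1))                              ≡⟨ cong (λ r → + 1 *ℤ (r *ℤ - (+ 1))) (at-R k zx zy k<n (source<n x<n vx) (source<n y<n vy)) ⟩
      + 1 *ℤ ((𝟙 ((zx ≟ K) ×-dec (zy ≟ 0)) -ℤ 𝟙 ((zx ≟ 0) ×-dec (zy ≟ K))) *ℤ - (+ 1))
          ≡⟨ cong₂ (λ a b → + 1 *ℤ ((a -ℤ b) *ℤ - (+ 1)))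
                   (𝟙-no ((zx ≟ K) ×-dec (zy ≟ 0)) (λ (_ , zy≡0) → wrapped≢0 ey zy≡0))
                   (𝟙-cong ((zx ≟ 0) ×-dec (zy ≟ K)) ((i ≟ x) ×-dec (x ≟ y + k)) to from) ⟩
      + 1 *ℤ ((+ 0 -ℤ 𝟙 ((i ≟ x) ×-dec (x ≟ y + k))) *ℤ - (+ 1))  ≡⟨ flip (𝟙 ((i ≟ x) ×-dec (x ≟ y + k))) ⟩
      + 0 +ℤ 𝟙 ((i ≟ x) ×-dec (x ≟ y + k))
          ≡⟨ cong (_+ℤ 𝟙 ((i ≟ x) ×-dec (x ≟ y + k)))
                  (𝟙-no ((i ≟ y) ×-dec (x ≟ y + K)) (λ (i≡y , _) → ℕₚ.<-irrefl (sym i≡y) y<i)) ⟨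
      lowerEntry                                                   ∎
      where
      open ≡-Reasoning
      vx = direct {n} zx ex
      vy = wrapped {n} zy ey y<i
      flip : ∀ b → + 1 *ℤ ((+ 0 -ℤ b) *ℤ - (+ 1)) ≡ + 0 +ℤ b
      flip = solve-∀
      y+k+K≡y+n : y + k + K ≡ y + n
      y+k+K≡y+n = trans (ℕₚ.+-assoc y k K) (cong (λ w → y + w) k+K≡n)
      to : zx ≡ 0 × zy ≡ K → i ≡ x × x ≡ y + k
      to (refl , refl) = ex , sym (ℕₚ.+-cancelʳ-≡ K (y + k) x
        (trans y+k+K≡y+n (trans ey (trans (ℕₚ.+-comm K i) (cong (_+ K) ex)))))
      from : i ≡ x × x ≡ y + k → zx ≡ 0 × zy ≡ K
      from (refl , x≡y+k) = cancel ex , cancel (trans (sym ey) (trans (sym y+k+K≡y+n) (trans (cong (_+ K) (sym x≡y+k)) (ℕₚ.+-comm i K))))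

    at-conj-R-wrapped : ∀ zx zy → x + n ≡ zx + i → y + n ≡ zy + i → x < i → y < i → at (conj i Rk) x y ≡ lowerEntry
    at-conj-R-wrapped zx zy ex ey x<i y<i = begin
      at (conj i Rk) x y                                           ≡⟨ at-conj Rk vx vy i≤n x<n y<n ⟩
      - (+ 1) *ℤ (at Rk zx zy *ℤ - (+ 1))                          ≡⟨ cong (λ r → - (+ 1) *ℤ (r *ℤ - (+ 1))) (at-R k zx zy k<n (source<n x<n vx) (source<n y<n vy)) ⟩
      - (+ 1) *ℤ ((𝟙 ((zx ≟ K) ×-dec (zy ≟ 0)) -ℤ 𝟙 ((zx ≟ 0) ×-dec (zy ≟ K))) *ℤ - (+ 1))
          ≡⟨ cong₂ (λ a b → - (+ 1) *ℤ ((a -ℤ b) *ℤ - (+ 1)))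
                   (𝟙-no ((zx ≟ K) ×-dec (zy ≟ 0)) (λ (_ , zy≡0) → wrapped≢0 ey zy≡0))
                   (𝟙-no ((zx ≟ 0) ×-dec (zy ≟ K)) (λ (zx≡0 , _) → wrapped≢0 ex zx≡0)) ⟩
      + 0
          ≡⟨ cong₂ _+ℤ_ (𝟙-no ((i ≟ y) ×-dec (x ≟ y + K)) (λ (i≡y , _) → ℕₚ.<-irrefl (sym i≡y) y<i))
                        (𝟙-no ((i ≟ x) ×-dec (x ≟ y + k)) (λ (i≡x , _) → ℕₚ.<-irrefl (sym i≡x) x<i)) ⟨
      lowerEntry                                                   ∎
      where
      open ≡-Reasoning
      vx = wrapped {n} zx ex x<i
      vy = wrapped {n} zy ey y<i

at-conj-R-lower : ∀ {n} k i x y → k < n → i < n → y < x → x < n →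
  at (conj i (R {n} k)) x y ≡ 𝟙 ((i ≟ y) ×-dec (x ≟ y + (n ∸ k))) +ℤ 𝟙 ((i ≟ x) ×-dec (x ≟ y + k))
at-conj-R-lower {n} k i x y k<n i<n y<x x<n
  with cyclicPreimage i x (ℕₚ.<⇒≤ i<n) | cyclicPreimage i y (ℕₚ.<⇒≤ i<n)
... | direct zx ex | direct zy ey = at-conj-R-direct k<n i<n y<x x<n zx zy ex ey
... | direct zx ex | wrapped zy ey y<i = at-conj-R-mixed k<n i<n y<x x<n zx zy ex ey y<i
... | wrapped zx ex x<i | wrapped zy ey y<i = at-conj-R-wrapped k<n i<n y<x x<n zx zy ex ey x<i y<i
... | wrapped _ _ x<i | direct zy ey =
  contradiction (ℕₚ.≤-<-trans (subst (i ≤_) ey (ℕₚ.m≤n+m i zy)) (ℕₚ.<-trans y<x x<i)) (ℕₚ.<-irrefl refl)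

-- prim n k is definitionally sumMat0 (primLength n k) (λ i → conj i (R k)).
primLength : ℕ → ℕ → ℕ
primLength n k = if n == k + k then k else n

primLength≤n : ∀ n k → primLength n k ≤ n
primLength≤n n k with n ≟ k + k
... | yes n≡k+k = ℕₚ.≤-trans (ℕₚ.m≤m+n k k) (ℕₚ.≤-reflexive (sym n≡k+k))
... | no _ = ℕₚ.≤-refl

primLength-even : ∀ {n k} → n ≡ k + k → primLength n k ≡ k
primLength-even n≡k+k rewrite ==-true n≡k+k = refl

primLength-odd : ∀ {n k} → n ≢ k + k → primLength n k ≡ n
primLength-odd n≢k+k rewrite ==-false n≢k+k = refl

at-prim-lower : ∀ {n} k x y → k < n → y < x → x < n →
  at (prim n k) x y ≡ 𝟙 ((y <? primLength n k) ×-dec (x ≟ y + (n ∸ k))) +ℤ 𝟙 ((x <? primLength n k) ×-dec (x ≟ y + k))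
at-prim-lower {n} k x y k<n y<x x<n = begin
  at (prim n k) x y                        ≡⟨ at-sumMat0 c (λ i → conj i (R {n} k)) x y x<n (ℕₚ.<-trans y<x x<n) ⟩
  ∑< c (λ i → at (conj i (R {n} k)) x y)   ≡⟨ ∑<-cong c (λ i i<c → at-conj-R-lower k i x y k<n (ℕₚ.<-≤-trans i<c (primLength≤n n k)) y<x x<n) ⟩
  ∑< c (λ i → 𝟙 ((i ≟ y) ×-dec (x ≟ y + (n ∸ k))) +ℤ 𝟙 ((i ≟ x) ×-dec (x ≟ y + k)))  ≡⟨ ∑<-+ c _ _ ⟩
  ∑< c (λ i → 𝟙 ((i ≟ y) ×-dec (x ≟ y + (n ∸ k)))) +ℤ ∑< c (λ i → 𝟙 ((i ≟ x) ×-dec (x ≟ y + k)))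
                                                                     ≡⟨ cong₂ _+ℤ_ (∑<-𝟙 c y (x ≟ y + (n ∸ k))) (∑<-𝟙 c x (x ≟ y + k)) ⟩
  𝟙 ((y <? c) ×-dec (x ≟ y + (n ∸ k))) +ℤ 𝟙 ((x <? c) ×-dec (x ≟ y + k))  ∎
  where
  open ≡-Reasoning
  c = primLength n k

prim-skew : ∀ {n} k → k < n → SkewSymmetric (prim n k)
prim-skew {n} k k<n = sumMat0-skew (primLength n k) (λ i → conj i (R k))
  (λ i i<c → conj-skew i (ℕₚ.<⇒≤ (ℕₚ.<-≤-trans i<c (primLength≤n n k))) (R-skew k k<n))

FloorHalf : ℕ → ℕ → Set
FloorHalf n s = n ≡ s + s ⊎ n ≡ suc (s + s)

FloorHalf-≤⇒< : ∀ {n s j} → FloorHalf n s → 1 ≤ j → j ≤ s → j < n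
FloorHalf-≤⇒< {j = j} (inj₁ n≡s+s) 1≤j j≤s =
  ℕₚ.<-≤-trans (ℕₚ.<-≤-trans (ℕₚ.m<m+n j 1≤j) (ℕₚ.+-mono-≤ j≤s j≤s)) (ℕₚ.≤-reflexive (sym n≡s+s))
FloorHalf-≤⇒< {s = s} (inj₂ n≡1+s+s) 1≤j j≤s =
  ℕₚ.≤-trans (s≤s (ℕₚ.≤-trans j≤s (ℕₚ.m≤m+n s s))) (ℕₚ.≤-reflexive (sym n≡1+s+s))

FloorHalf-≤+ : ∀ {n s d} → FloorHalf n s → s < d → n ≤ d + s
FloorHalf-≤+ {s = s} (inj₁ n≡s+s) s<d = ℕₚ.≤-trans (ℕₚ.≤-reflexive n≡s+s) (ℕₚ.+-monoˡ-≤ s (ℕₚ.<⇒≤ s<d))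
FloorHalf-≤+ {s = s} (inj₂ n≡1+s+s) s<d = ℕₚ.≤-trans (ℕₚ.≤-reflexive n≡1+s+s) (ℕₚ.+-monoˡ-≤ s s<d)

FloorHalf-+≡n : ∀ {n s a b} → FloorHalf n s → a ≤ s → b ≤ s → a + b ≡ n → a ≡ b
FloorHalf-+≡n (inj₂ n≡1+s+s) a≤s b≤s a+b≡n =
  contradiction (ℕₚ.+-mono-≤ a≤s b≤s) (ℕₚ.<⇒≱ (ℕₚ.≤-reflexive (sym (trans a+b≡n n≡1+s+s))))
FloorHalf-+≡n {s = s} {a} {b} (inj₁ n≡s+s) a≤s b≤s a+b≡n = trans a≡s (sym b≡s)
  where
  a+b≡s+s = trans a+b≡n n≡s+s
  a≡s : a ≡ s
  a≡s = ℕₚ.≤-antisym a≤s (ℕₚ.+-cancelʳ-≤ s s a (ℕₚ.≤-trans (ℕₚ.≤-reflexive (sym a+b≡s+s)) (ℕₚ.+-monoʳ-≤ a b≤s)))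
  b≡s : b ≡ s
  b≡s = ℕₚ.≤-antisym b≤s (ℕₚ.+-cancelˡ-≤ s s b (ℕₚ.≤-trans (ℕₚ.≤-reflexive (sym a+b≡s+s)) (ℕₚ.+-monoˡ-≤ b a≤s)))

FloorHalf-double< : ∀ {N r a} → FloorHalf N r → suc (a + a) < N → a < r
FloorHalf-double< {N} {r} {a} half lt = ℕₚ.≰⇒> λ r≤a → ℕₚ.<-irrefl refl (ℕₚ.<-≤-trans lt (ℕₚ.≤-trans (N≤ half) (s≤s (ℕₚ.+-mono-≤ r≤a r≤a))))
  where
  N≤ : FloorHalf N r → N ≤ suc (r + r)
  N≤ (inj₁ N≡r+r) = ℕₚ.≤-trans (ℕₚ.≤-reflexive N≡r+r) (ℕₚ.n≤1+n _)
  N≤ (inj₂ N≡1+r+r) = ℕₚ.≤-reflexive N≡1+r+r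

LowerToeplitz : ∀ {m} → Mat m → Set
LowerToeplitz {m} M = ∀ z d → 1 ≤ d → z + d < m → at M (z + d) z ≡ at M d 0

module _ {n s : ℕ} (half : FloorHalf n s) where

  Btilde-skew : ∀ μ → SkewSymmetric (Btilde n s μ)
  Btilde-skew μ = sumMat0-skew s (λ j → μ (suc j) ·ₘ prim n (suc j))
    (λ j j<s → ·ₘ-skew (μ (suc j)) (prim-skew (suc j) (FloorHalf-≤⇒< half (s≤s z≤n) j<s)))

  at-Btilde-single : ∀ μ x y e → x < n → y < n → 1 ≤ e → e ≤ s →
    (∀ j → 1 ≤ j → j ≤ s → j ≢ e → at (prim n j) x y ≡ + 0) → at (prim n e) x y ≡ + 1 →
    at (Btilde n s μ) x y ≡ μ e
  at-Btilde-single μ x y (suc e′) x<n y<n _ e≤s off-e at-e = begin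
    at (Btilde n s μ) x y                                    ≡⟨ at-sumMat0 s _ x y x<n y<n ⟩
    ∑< s (λ j → at (μ (suc j) ·ₘ prim n (suc j)) x y)        ≡⟨ ∑<-cong s (λ j _ → at-·ₘ (μ (suc j)) (prim n (suc j)) x y x<n y<n) ⟩
    ∑< s (λ j → μ (suc j) *ℤ at (prim n (suc j)) x y)        ≡⟨ ∑<-single s e′ e≤s (λ j j<s j≢e′ →
                                                                   trans (cong (μ (suc j) *ℤ_) (off-e (suc j) (s≤s z≤n) j<s (λ e → j≢e′ (ℕₚ.suc-injective e))))
                                                                         (ℤₚ.*-zeroʳ (μ (suc j)))) ⟩
    μ (suc e′) *ℤ at (prim n (suc e′)) x y                   ≡⟨ trans (cong (μ (suc e′) *ℤ_) at-e) (ℤₚ.*-identityʳ _) ⟩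
    μ (suc e′)                                               ∎
    where open ≡-Reasoning

  at-Btilde-lower-≤ : ∀ μ y d → 1 ≤ d → d ≤ s → y + d < n → at (Btilde n s μ) (y + d) y ≡ μ d
  at-Btilde-lower-≤ μ y d 1≤d d≤s y+d<n =
    at-Btilde-single μ (y + d) y d y+d<n y<n 1≤d d≤s off-d at-d
    where
    y<y+d = ℕₚ.m<m+n y 1≤d
    y<n = ℕₚ.<-trans y<y+d y+d<n
    d<n = FloorHalf-≤⇒< half 1≤d d≤s
    off-d : ∀ j → 1 ≤ j → j ≤ s → j ≢ d → at (prim n j) (y + d) y ≡ + 0
    off-d j 1≤j j≤s j≢d = trans (at-prim-lower j (y + d) y j<n y<y+d y+d<n)
      (cong₂ _+ℤ_ (𝟙-no ((y <? primLength n j) ×-dec (y + d ≟ y + (n ∸ j)))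
                        (λ (_ , e) → j≢d (sym (FloorHalf-+≡n half d≤s j≤s
                                      (trans (cong (_+ j) (ℕₚ.+-cancelˡ-≡ y d (n ∸ j) e)) (ℕₚ.m∸n+n≡m (ℕₚ.<⇒≤ j<n)))))))
                  (𝟙-no ((y + d <? primLength n j) ×-dec (y + d ≟ y + j))
                        (λ (_ , e) → j≢d (sym (ℕₚ.+-cancelˡ-≡ y d j e)))))
      where j<n = FloorHalf-≤⇒< half 1≤j j≤s
    at-d : at (prim n d) (y + d) y ≡ + 1
    at-d = by-parity (n ≟ d + d)
      where
      by-parity : Dec (n ≡ d + d) → at (prim n d) (y + d) y ≡ + 1
      by-parity (yes n≡d+d) =
        trans (at-prim-lower d (y + d) y d<n y<y+d y+d<n)
              (cong₂ _+ℤ_ (𝟙-yes ((y <? primLength n d) ×-dec (y + d ≟ y + (n ∸ d)))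
                                 (subst (y <_) (sym (primLength-even n≡d+d)) (ℕₚ.+-cancelʳ-< d y d (subst (y + d <_) n≡d+d y+d<n)) ,
                                  cong (λ w → y + w) (sym (trans (cong (_∸ d) n≡d+d) (ℕₚ.m+n∸n≡m d d)))))
                          (𝟙-no ((y + d <? primLength n d) ×-dec (y + d ≟ y + d))
                                (λ (y+d<c , _) → ℕₚ.<-irrefl refl (ℕₚ.<-≤-trans (subst (y + d <_) (primLength-even n≡d+d) y+d<c) (ℕₚ.m≤n+m d y)))))
      by-parity (no n≢d+d) =
        trans (at-prim-lower d (y + d) y d<n y<y+d y+d<n)
              (cong₂ _+ℤ_ (𝟙-no ((y <? primLength n d) ×-dec (y + d ≟ y + (n ∸ d)))
                                (λ (_ , e) → n≢d+d (trans (sym (ℕₚ.m∸n+n≡m (ℕₚ.<⇒≤ d<n))) (cong (_+ d) (sym (ℕₚ.+-cancelˡ-≡ y d (n ∸ d) e))))))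
                          (𝟙-yes ((y + d <? primLength n d) ×-dec (y + d ≟ y + d))
                                 (subst (y + d <_) (sym (primLength-odd n≢d+d)) y+d<n , refl)))

  at-Btilde-lower-> : ∀ μ y d → s < d → y + d < n → at (Btilde n s μ) (y + d) y ≡ μ (n ∸ d)
  at-Btilde-lower-> μ y d s<d y+d<n =
    at-Btilde-single μ (y + d) y e y+d<n y<n 1≤e e≤s off-e at-e
    where
    e = n ∸ d
    y<y+d = ℕₚ.m<m+n y (ℕₚ.≤-<-trans z≤n s<d)
    y<n = ℕₚ.<-trans y<y+d y+d<n
    d<n = ℕₚ.≤-<-trans (ℕₚ.m≤n+m d y) y+d<n
    1≤e : 1 ≤ e
    1≤e = ℕₚ.m<n⇒0<n∸m d<n
    e≤s : e ≤ s
    e≤s = ℕₚ.m≤n+o⇒m∸n≤o n d (FloorHalf-≤+ half s<d)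
    e<n = FloorHalf-≤⇒< half 1≤e e≤s
    d≢≤s : ∀ {j} → j ≤ s → d ≢ j
    d≢≤s j≤s refl = ℕₚ.<-irrefl refl (ℕₚ.<-≤-trans s<d j≤s)
    off-e : ∀ j → 1 ≤ j → j ≤ s → j ≢ e → at (prim n j) (y + d) y ≡ + 0
    off-e j 1≤j j≤s j≢e = trans (at-prim-lower j (y + d) y j<n y<y+d y+d<n)
      (cong₂ _+ℤ_ (𝟙-no ((y <? primLength n j) ×-dec (y + d ≟ y + (n ∸ j)))
                        (λ (_ , e′) → j≢e (trans (sym (ℕₚ.m∸[m∸n]≡n (ℕₚ.<⇒≤ j<n))) (cong (n ∸_) (sym (ℕₚ.+-cancelˡ-≡ y d (n ∸ j) e′))))))
                  (𝟙-no ((y + d <? primLength n j) ×-dec (y + d ≟ y + j))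
                        (λ (_ , e′) → d≢≤s j≤s (ℕₚ.+-cancelˡ-≡ y d j e′))))
      where j<n = FloorHalf-≤⇒< half 1≤j j≤s
    at-e : at (prim n e) (y + d) y ≡ + 1
    at-e = trans (at-prim-lower e (y + d) y e<n y<y+d y+d<n)
      (cong₂ _+ℤ_ (𝟙-yes ((y <? primLength n e) ×-dec (y + d ≟ y + (n ∸ e)))
                         (subst (y <_) (sym c≡n) y<n , cong (λ w → y + w) (sym (ℕₚ.m∸[m∸n]≡n (ℕₚ.<⇒≤ d<n)))))
                  (𝟙-no ((y + d <? primLength n e) ×-dec (y + d ≟ y + e)) (λ (_ , e′) → d≢≤s e≤s (ℕₚ.+-cancelˡ-≡ y d e e′))))
      where
      c≡n : primLength n e ≡ n
      c≡n = primLength-odd (λ n≡e+e → d≢≤s e≤s (sym (ℕₚ.+-cancelˡ-≡ e e d (trans (sym n≡e+e) (sym (ℕₚ.m∸n+n≡m (ℕₚ.<⇒≤ d<n)))))))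

  at-Btilde-toeplitz : ∀ μ → LowerToeplitz (Btilde n s μ)
  at-Btilde-toeplitz μ z d 1≤d z+d<n with d ≤? s
  ... | yes d≤s = trans (at-Btilde-lower-≤ μ z d 1≤d d≤s z+d<n) (sym (at-Btilde-lower-≤ μ 0 d 1≤d d≤s d<n))
    where d<n = ℕₚ.≤-<-trans (ℕₚ.m≤n+m d z) z+d<n
  ... | no d≰s = trans (at-Btilde-lower-> μ z d (ℕₚ.≰⇒> d≰s) z+d<n) (sym (at-Btilde-lower-> μ 0 d (ℕₚ.≰⇒> d≰s) d<n))
    where d<n = ℕₚ.≤-<-trans (ℕₚ.m≤n+m d z) z+d<n

at-embed : ∀ {m N} K (M : Mat m) x y → x < N → y < N →
  at (embed {m} {N} K M) x y ≡ (if (K ≤ᵇ x) ∧ (K ≤ᵇ y) then at M (x ∸ K) (y ∸ K) else + 0)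
at-embed K M x y x<N y<N rewrite at-inside (embed K M) x y x<N y<N | toℕ-fromℕ< x<N | toℕ-fromℕ< y<N = refl

embed-skew : ∀ {m N} K {M : Mat m} → SkewSymmetric M → SkewSymmetric (embed {m} {N} K M)
embed-skew K {M} skew a b with K ≤? toℕ a | K ≤? toℕ b
... | yes _ | yes _ = at-skew skew _ _
... | yes _ | no _ = refl
... | no _ | yes _ = refl
... | no _ | no _ = refl

at-embed-lower : ∀ {m N} K (M : Mat m) → LowerToeplitz M → m + K + K ≡ N → ∀ y d → 1 ≤ d → y + d < N →
  at (embed {m} {N} K M) (y + d) y ≡ 𝟙 ((K ≤? y) ×-dec (y + d + K <? N)) *ℤ at M d 0
at-embed-lower {m} {N} K M toeplitz m+K+K≡N y d 1≤d y+d<N =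
  trans (at-embed K M (y + d) y y+d<N (ℕₚ.≤-<-trans (ℕₚ.m≤m+n y d) y+d<N)) (by-position (K ≤? y) (y + d + K <? N))
  where
  v = at M d 0
  by-position : (K≤y? : Dec (K ≤ y)) (inside? : Dec (y + d + K < N)) →
    (if (K ≤ᵇ y + d) ∧ (K ≤ᵇ y) then at M (y + d ∸ K) (y ∸ K) else + 0) ≡ 𝟙 (K≤y? ×-dec inside?) *ℤ v
  by-position (no K≰y) _ rewrite ≤ᵇ-false K≰y | ∧-zeroʳ (K ≤ᵇ y + d) = sym (ℤₚ.*-zeroˡ v)
  by-position (yes K≤y) inside? rewrite ≤ᵇ-true (ℕₚ.≤-trans K≤y (ℕₚ.m≤m+n y d)) | ≤ᵇ-true K≤y
                                      | ℕₚ.+-∸-comm d K≤y = by-range inside?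
    where
    shifted : y ∸ K + d + K + K ≡ y + d + K
    shifted = cong (_+ K) (trans (ℕₚ.+-assoc (y ∸ K) d K) (trans (cong (λ w → y ∸ K + w) (ℕₚ.+-comm d K))
                (trans (sym (ℕₚ.+-assoc (y ∸ K) K d)) (cong (_+ d) (ℕₚ.m∸n+n≡m K≤y)))))
    by-range : (inside? : Dec (y + d + K < N)) → at M (y ∸ K + d) (y ∸ K) ≡ 𝟙 (yes K≤y ×-dec inside?) *ℤ v
    by-range (yes inside) =
      trans (toeplitz (y ∸ K) d 1≤d (ℕₚ.+-cancelʳ-< K (y ∸ K + d) m (ℕₚ.+-cancelʳ-< K _ (m + K)
                (subst₂ _<_ (sym shifted) (sym m+K+K≡N) inside))))
            (sym (ℤₚ.*-identityˡ v))
    by-range (no outside) =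
      trans (at-outsideˡ M (y ∸ K + d) (y ∸ K) (λ inside → outside
                (subst₂ _<_ shifted m+K+K≡N (ℕₚ.+-monoˡ-< K (ℕₚ.+-monoˡ-< K inside)))))
            (sym (ℤₚ.*-zeroˡ v))

-- Mutation at vertex 1

-- ε B i j is definitionally εℤ (mcoef B i) (mcoef B j).
εℤ : ℤ → ℤ → ℤ
εℤ p q = (p *ℤ + ∣ q ∣ -ℤ q *ℤ + ∣ p ∣) / + 2

half-of-double : ∀ w → (w *ℤ + 2) / + 2 ≡ w
half-of-double (+ k) = begin
  (+ k *ℤ + 2) / + 2         ≡⟨ cong (_/ + 2) (sym (ℤₚ.pos-* k 2)) ⟩
  + (k ℕ.* 2) / + 2          ≡⟨ ℤₚ.*-identityˡ _ ⟩
  + (k ℕ.* 2 DivMod./ 2)     ≡⟨ cong +_ (DivMod.m*n/n≡m k 2) ⟩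
  + k                        ∎
  where open ≡-Reasoning
half-of-double -[1+ k ] with suc k ℕ.* 2 DivMod.% 2 | DivMod.m*n%n≡0 (suc k) 2
... | zero | _ = trans (ℤₚ.*-identityˡ _) (cong -_ (cong +_ (DivMod.m*n/n≡m (suc k) 2)))

numerator-even : ∀ p q → ∃ λ w → p *ℤ + ∣ q ∣ -ℤ q *ℤ + ∣ p ∣ ≡ w *ℤ + 2
numerator-even (+ a) (+ b) = + 0 , same-sign (+ a) (+ b)
  where
  same-sign : ∀ a b → a *ℤ b -ℤ b *ℤ a ≡ + 0 *ℤ + 2
  same-sign = solve-∀
numerator-even (+ a) -[1+ b ] = + a *ℤ + suc b , opposite (+ a) (+ suc b)
  where
  opposite : ∀ a b → a *ℤ b -ℤ (- b) *ℤ a ≡ (a *ℤ b) *ℤ + 2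
  opposite = solve-∀
numerator-even -[1+ a ] (+ b) = - (+ suc a *ℤ + b) , opposite (+ suc a) (+ b)
  where
  opposite : ∀ a b → (- a) *ℤ b -ℤ b *ℤ a ≡ (- (a *ℤ b)) *ℤ + 2
  opposite = solve-∀
numerator-even -[1+ a ] -[1+ b ] = + 0 , same-sign (+ suc a) (+ suc b)
  where
  same-sign : ∀ a b → (- a) *ℤ b -ℤ (- b) *ℤ a ≡ + 0 *ℤ + 2
  same-sign = solve-∀

εℤ-antisym : ∀ p q → εℤ p q ≡ - εℤ q p
εℤ-antisym p q with numerator-even p q
... | w , numerator≡2w = begin
  εℤ p q                       ≡⟨ cong (_/ + 2) numerator≡2w ⟩
  (w *ℤ + 2) / + 2             ≡⟨ half-of-double w ⟩
  w                            ≡⟨ ℤₚ.neg-involutive w ⟨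
  - - w                        ≡⟨ cong -_ (half-of-double (- w)) ⟨
  - ((- w *ℤ + 2) / + 2)       ≡⟨ cong (λ t → - (t / + 2)) (trans (cong -_ numerator≡2w) (ℤₚ.neg-distribˡ-* w (+ 2))) ⟨
  - ((- (p *ℤ + ∣ q ∣ -ℤ q *ℤ + ∣ p ∣)) / + 2)  ≡⟨ cong (λ t → - (t / + 2)) (swap p q (+ ∣ p ∣) (+ ∣ q ∣)) ⟩
  - εℤ q p                     ∎
  where
  open ≡-Reasoning
  swap : ∀ p q P Q → - (p *ℤ Q -ℤ q *ℤ P) ≡ q *ℤ P -ℤ p *ℤ Q
  swap = solve-∀

εℤ-diag : ∀ p → εℤ p p ≡ + 0
εℤ-diag p = cong (_/ + 2) (cancel p (+ ∣ p ∣))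
  where
  cancel : ∀ p P → p *ℤ P -ℤ p *ℤ P ≡ + 0
  cancel = solve-∀

suc[m∸suc[n]]≡m∸n : ∀ {m n} → n < m → suc (m ∸ suc n) ≡ m ∸ n
suc[m∸suc[n]]≡m∸n n<m = sym (ℕₚ.+-∸-assoc 1 n<m)

m∸suc[m∸suc[n]]≡n : ∀ {m n} → n < m → m ∸ suc (m ∸ suc n) ≡ n
m∸suc[m∸suc[n]]≡n {m} n<m = trans (cong (m ∸_) (suc[m∸suc[n]]≡m∸n n<m)) (ℕₚ.m∸[m∸n]≡n (ℕₚ.<⇒≤ n<m))

εℤ-mirror-sum : ∀ (f : ℕ → ℤ) c → ∑< c (λ u → εℤ (f (suc (c ∸ suc u))) (f (suc u))) ≡ + 0
εℤ-mirror-sum f c = self-negating (∑< c g) (begin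
  ∑< c g                        ≡⟨ ∑<-reverse c g ⟩
  ∑< c (λ u → g (c ∸ suc u))    ≡⟨ ∑<-cong c (λ u u<c → trans (cong (λ a → εℤ (f (suc a)) (f (suc (c ∸ suc u)))) (m∸suc[m∸suc[n]]≡n u<c))
                                                              (εℤ-antisym (f (suc u)) (f (suc (c ∸ suc u))))) ⟩
  ∑< c (λ u → - g u)            ≡⟨ ∑<-neg c g ⟩
  - ∑< c g                      ∎)
  where
  open ≡-Reasoning
  g : ℕ → ℤ
  g u = εℤ (f (suc (c ∸ suc u))) (f (suc u))

module _ {N} (B : Mat (suc N)) (skew : SkewSymmetric B) (period : MutationPeriod1 B) where
  open SignedCycle (ρ-isSignedCycle {suc N})

  private
    at-μ₁ : ∀ x y → x < suc N → y < suc N → at (mutate Fin.zero B) x y ≡ at (ρ *ₘ (B *ₘ ρ⁻¹)) x y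
    at-μ₁ x y x<n y<n = trans (at-inside (mutate Fin.zero B) x y x<n y<n)
      (trans (period Fin.zero refl _ _) (sym (at-inside (ρ *ₘ (B *ₘ ρ⁻¹)) x y x<n y<n)))

    at-ρBρ⁻¹ : ∀ x y → suc x < suc N → suc y < suc N → at (ρ *ₘ (B *ₘ ρ⁻¹)) (suc x) (suc y) ≡ at B x y
    at-ρBρ⁻¹ x y sx<n sy<n = trans (*ₘ-suc (B *ₘ ρ⁻¹) x (suc y) sx<n sy<n) (*ₘᵀ-suc B x y (ℕₚ.<⇒≤ sx<n) sy<n)

    at-μ₁-inner : ∀ a c → suc a < suc N → suc c < suc N →
      at (mutate Fin.zero B) (suc a) (suc c) ≡
      at B (suc a) (suc c) +ℤ (+ ∣ at B (suc a) 0 ∣ *ℤ at B 0 (suc c) +ℤ at B (suc a) 0 *ℤ + ∣ at B 0 (suc c) ∣) / + 2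
    at-μ₁-inner a c sa<n sc<n
      rewrite at-inside (mutate Fin.zero B) (suc a) (suc c) sa<n sc<n
            | ==-false {suc a} {0} (λ ()) | ==-false {suc c} {0} (λ ())
            | at-inside B (suc a) (suc c) sa<n sc<n | at-inside B (suc a) 0 sa<n (s≤s z≤n) | at-inside B 0 (suc c) (s≤s z≤n) sc<n
      = refl

    at-μ₁-first-row : ∀ c → suc c < suc N → at (mutate Fin.zero B) 0 (suc c) ≡ - at B 0 (suc c)
    at-μ₁-first-row c sc<n
      rewrite at-inside (mutate Fin.zero B) 0 (suc c) (s≤s z≤n) sc<n | at-inside B 0 (suc c) (s≤s z≤n) sc<n
      = refl

  mutation-step : ∀ a c → suc a < suc N → suc c < suc N →
    at B (suc a) (suc c) ≡ at B a c -ℤ ε B (suc a) (suc c)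
  mutation-step a c sa<n sc<n = begin
    at B (suc a) (suc c)                                                ≡⟨ cancelʳ (at B (suc a) (suc c)) (ε B (suc a) (suc c)) ⟨
    at B (suc a) (suc c) +ℤ ε B (suc a) (suc c) -ℤ ε B (suc a) (suc c)  ≡⟨ cong (_-ℤ ε B (suc a) (suc c)) mutated ⟩
    at B a c -ℤ ε B (suc a) (suc c)                                     ∎
    where
    open ≡-Reasoning
    cancelʳ : ∀ b e → b +ℤ e -ℤ e ≡ b
    cancelʳ = solve-∀
    ma = at B (suc a) 0
    mc = at B (suc c) 0
    correction : (+ ∣ ma ∣ *ℤ at B 0 (suc c) +ℤ ma *ℤ + ∣ at B 0 (suc c) ∣) / + 2 ≡ ε B (suc a) (suc c)
    correction = cong (_/ + 2) (begin
      + ∣ ma ∣ *ℤ at B 0 (suc c) +ℤ ma *ℤ + ∣ at B 0 (suc c) ∣  ≡⟨ cong (λ b → + ∣ ma ∣ *ℤ b +ℤ ma *ℤ + ∣ b ∣) (at-skew skew 0 (suc c)) ⟩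
      + ∣ ma ∣ *ℤ (- mc) +ℤ ma *ℤ + ∣ - mc ∣                   ≡⟨ cong (λ w → + ∣ ma ∣ *ℤ (- mc) +ℤ ma *ℤ + w) (ℤₚ.∣-i∣≡∣i∣ mc) ⟩
      + ∣ ma ∣ *ℤ (- mc) +ℤ ma *ℤ + ∣ mc ∣                     ≡⟨ reorder (+ ∣ ma ∣) ma mc (+ ∣ mc ∣) ⟩
      ma *ℤ + ∣ mc ∣ -ℤ mc *ℤ + ∣ ma ∣                         ∎)
      where
      reorder : ∀ A a c C → A *ℤ (- c) +ℤ a *ℤ C ≡ a *ℤ C -ℤ c *ℤ A
      reorder = solve-∀
    mutated : at B (suc a) (suc c) +ℤ ε B (suc a) (suc c) ≡ at B a c
    mutated = begin
      at B (suc a) (suc c) +ℤ ε B (suc a) (suc c)  ≡⟨ cong (at B (suc a) (suc c) +ℤ_) correction ⟨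
      at B (suc a) (suc c) +ℤ (+ ∣ ma ∣ *ℤ at B 0 (suc c) +ℤ ma *ℤ + ∣ at B 0 (suc c) ∣) / + 2
                                                   ≡⟨ at-μ₁-inner a c sa<n sc<n ⟨
      at (mutate Fin.zero B) (suc a) (suc c)       ≡⟨ at-μ₁ (suc a) (suc c) sa<n sc<n ⟩
      at (ρ *ₘ (B *ₘ ρ⁻¹)) (suc a) (suc c)         ≡⟨ at-ρBρ⁻¹ a c sa<n sc<n ⟩
      at B a c                                     ∎

  mutation-last-row : ∀ c → suc c < suc N → at B N c ≡ mcoef B (suc c)
  mutation-last-row c sc<n = begin
    at B N c                                ≡⟨ *ₘᵀ-suc B N c ℕₚ.≤-refl sc<n ⟨
    at (B *ₘ ρ⁻¹) N (suc c)                 ≡⟨ ℤₚ.*-identityˡ _ ⟨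
    + 1 *ℤ at (B *ₘ ρ⁻¹) N (suc c)          ≡⟨ *ₘ-zero (B *ₘ ρ⁻¹) (suc c) (s≤s z≤n) sc<n ⟨
    at (ρ *ₘ (B *ₘ ρ⁻¹)) 0 (suc c)          ≡⟨ at-μ₁ 0 (suc c) (s≤s z≤n) sc<n ⟨
    at (mutate Fin.zero B) 0 (suc c)        ≡⟨ at-μ₁-first-row c sc<n ⟩
    - at B 0 (suc c)                        ≡⟨ cong -_ (at-skew skew 0 (suc c)) ⟩
    - - at B (suc c) 0                      ≡⟨ ℤₚ.neg-involutive _ ⟩
    mcoef B (suc c)                         ∎
    where open ≡-Reasoning

-- The period-1 recurrence

-- Indices are 0-based: `at M (suc y + d) (suc y)` is the paper's entry (y + d + 2, y + 2), and m x = b_{x+1,1}.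
record Period1Recurrence {N} (m : ℕ → ℤ) (M : Mat N) : Set where
  field
    skew         : SkewSymmetric M
    first-column : ∀ x → 1 ≤ x → x < N → at M x 0 ≡ m x
    step         : ∀ y d → 1 ≤ d → suc y + d < N →
                   at M (suc y + d) (suc y) ≡ at M (y + d) y -ℤ εℤ (m (suc y + d)) (m (suc y))

period1-recurrence : ∀ {N} (B : Mat (suc N)) → SkewSymmetric B → MutationPeriod1 B → Period1Recurrence (mcoef B) B
period1-recurrence B skew period = record
  { skew = skew
  ; first-column = λ _ _ _ → refl
  ; step = λ y d _ lt → mutation-step B skew period (y + d) y lt (ℕₚ.≤-<-trans (s≤s (ℕₚ.m≤m+n y d)) lt)
  }

reflect-index : ∀ {N c u} → u < c → suc c ≤ N → suc u + (N ∸ suc c) ≡ N ∸ suc (c ∸ suc u)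
reflect-index {N} {c} {u} u<c sc≤N = begin
  suc u + d                                ≡⟨ ℕₚ.m+n∸n≡m (suc u + d) (c ∸ u) ⟨
  suc u + d + (c ∸ u) ∸ (c ∸ u)            ≡⟨ cong (_∸ (c ∸ u)) total ⟩
  N ∸ (c ∸ u)                              ≡⟨ cong (N ∸_) (suc[m∸suc[n]]≡m∸n u<c) ⟨
  N ∸ suc (c ∸ suc u)                      ∎
  where
  open ≡-Reasoning
  d = N ∸ suc c
  total : suc u + d + (c ∸ u) ≡ N
  total = begin
    suc u + d + (c ∸ u)                    ≡⟨ cong (_+ (c ∸ u)) (ℕₚ.+-comm (suc u) d) ⟩
    d + suc u + (c ∸ u)                    ≡⟨ ℕₚ.+-assoc d (suc u) (c ∸ u) ⟩
    d + suc (u + (c ∸ u))                  ≡⟨ cong (λ w → d + suc w) (ℕₚ.m+[n∸m]≡n (ℕₚ.<⇒≤ u<c)) ⟩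
    d + suc c                              ≡⟨ ℕₚ.m∸n+n≡m sc≤N ⟩
    N                                      ∎

module _ {N} {m : ℕ → ℤ} {M : Mat N} (rec : Period1Recurrence m M) where
  open Period1Recurrence rec

  diagonal-sum : ∀ t d → 1 ≤ d → t + d < N → at M (t + d) t ≡ m d -ℤ ∑< t (λ u → εℤ (m (suc u + d)) (m (suc u)))
  diagonal-sum zero d 1≤d d<N = trans (first-column d 1≤d d<N) (sym (ℤₚ.+-identityʳ (m d)))
  diagonal-sum (suc t) d 1≤d lt = begin
    at M (suc t + d) (suc t)                    ≡⟨ step t d 1≤d lt ⟩
    at M (t + d) t -ℤ e t                       ≡⟨ cong (_-ℤ e t) (diagonal-sum t d 1≤d (ℕₚ.<-trans (ℕₚ.n<1+n _) lt)) ⟩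
    m d -ℤ ∑< t e -ℤ e t                        ≡⟨ sub-sub (m d) (∑< t e) (e t) ⟩
    m d -ℤ ∑< (suc t) e                         ∎
    where
    open ≡-Reasoning
    e = λ u → εℤ (m (suc u + d)) (m (suc u))
    sub-sub : ∀ a s x → a -ℤ s -ℤ x ≡ a -ℤ (s +ℤ x)
    sub-sub = solve-∀

  palindrome : (∀ c → suc c < N → at M (N ∸ 1) c ≡ m (suc c)) → ∀ j → 1 ≤ j → j < N → m (N ∸ j) ≡ m j
  palindrome last-row (suc c) _ = <-rec (λ c → suc c < N → m (N ∸ suc c) ≡ m (suc c)) pal-step c
    where
    pal-step : ∀ c → (∀ {c′} → c′ < c → suc c′ < N → m (N ∸ suc c′) ≡ m (suc c′)) → suc c < N → m (N ∸ suc c) ≡ m (suc c)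
    -- The last row, read from (N - 1, c) up its subdiagonal, starts at m (N - 1 - c).
    pal-step c IH sc<N = begin
      m d                                                  ≡⟨ ℤₚ.+-identityʳ (m d) ⟨
      m d -ℤ + 0                                           ≡⟨ cong (m d -ℤ_) (trans (∑<-cong c mirror) (εℤ-mirror-sum m c)) ⟨
      m d -ℤ ∑< c (λ u → εℤ (m (suc u + d)) (m (suc u)))   ≡⟨ diagonal-sum c d 1≤d c+d<N ⟨
      at M (c + d) c                                       ≡⟨ cong (λ w → at M w c) c+d≡N∸1 ⟩
      at M (N ∸ 1) c                                       ≡⟨ last-row c sc<N ⟩
      m (suc c)                                            ∎
      where
      open ≡-Reasoning
      d = N ∸ suc c
      1≤d = ℕₚ.m<n⇒0<n∸m sc<N
      c+d≡N∸1 : c + d ≡ N ∸ 1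
      c+d≡N∸1 = cong (_∸ 1) (trans (ℕₚ.+-comm (suc c) d) (ℕₚ.m∸n+n≡m (ℕₚ.<⇒≤ sc<N)))
      c+d<N = subst (_< N) (sym c+d≡N∸1) (n∸1<n (ℕₚ.<-trans (s≤s z≤n) sc<N))
      mirror : ∀ u → u < c → εℤ (m (suc u + d)) (m (suc u)) ≡ εℤ (m (suc (c ∸ suc u))) (m (suc u))
      mirror u u<c = cong (λ w → εℤ w (m (suc u)))
        (trans (cong m (reflect-index u<c (ℕₚ.<⇒≤ sc<N)))
               (IH (ℕₚ.<-≤-trans (ℕₚ.∸-monoʳ-< {c} {suc u} {0} (s≤s z≤n) u<c) ℕₚ.≤-refl)
                   (ℕₚ.≤-<-trans (s≤s (ℕₚ.m∸n≤m c (suc u))) sc<N)))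

Period1Recurrence-unique : ∀ {N} {m : ℕ → ℤ} {A B : Mat N} → Period1Recurrence m A → Period1Recurrence m B → A ≈ₘ B
Period1Recurrence-unique {N} {m} {A} {B} recA recB = at-entrywise same
  where
  module A = Period1Recurrence recA
  module B = Period1Recurrence recB
  same-lower : ∀ y d → 1 ≤ d → y + d < N → at A (y + d) y ≡ at B (y + d) y
  same-lower zero d 1≤d d<N = trans (A.first-column d 1≤d d<N) (sym (B.first-column d 1≤d d<N))
  same-lower (suc y) d 1≤d lt = begin
    at A (suc y + d) (suc y)                       ≡⟨ A.step y d 1≤d lt ⟩
    at A (y + d) y -ℤ εℤ (m (suc y + d)) (m (suc y)) ≡⟨ cong (_-ℤ εℤ (m (suc y + d)) (m (suc y))) (same-lower y d 1≤d (ℕₚ.<-trans (ℕₚ.n<1+n _) lt)) ⟩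
    at B (y + d) y -ℤ εℤ (m (suc y + d)) (m (suc y)) ≡⟨ B.step y d 1≤d lt ⟨
    at B (suc y + d) (suc y)                       ∎
    where open ≡-Reasoning
  same-below : ∀ x y → y < x → x < N → at A x y ≡ at B x y
  same-below x y y<x x<N = subst (λ x → at A x y ≡ at B x y) y+[x∸y]≡x
    (same-lower y (x ∸ y) (ℕₚ.m<n⇒0<n∸m y<x) (subst (_< N) (sym y+[x∸y]≡x) x<N))
    where y+[x∸y]≡x = ℕₚ.m+[n∸m]≡n (ℕₚ.<⇒≤ y<x)
  same : ∀ x y → x < N → y < N → at A x y ≡ at B x y
  same x y x<N y<N with ℕₚ.<-cmp x y
  ... | tri< x<y _ _ = trans (at-skew A.skew x y) (trans (cong -_ (same-below y x x<y y<N)) (sym (at-skew B.skew x y)))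
  ... | tri≈ _ refl _ = trans (self-negating _ (at-skew A.skew x x)) (sym (self-negating _ (at-skew B.skew x x)))
  ... | tri> _ _ y<x = same-below x y y<x x<N

-- The right-hand side

<∸1⇒suc< : ∀ {i r} → i < r ∸ 1 → suc i < r
<∸1⇒suc< {r = suc r} i<r = s≤s i<r

suc<⇒<∸1 : ∀ {i r} → suc i < r → i < r ∸ 1
suc<⇒<∸1 {r = suc r} (s≤s i<r) = i<r

module Decomposition (N r : ℕ) (dim : ℕ → ℕ) (m : ℕ → ℤ)
  (half : FloorHalf N r)
  (block-half : ∀ K → 1 ≤ K → K < r → FloorHalf (dim K) (r ∸ K))
  (block-dim : ∀ K → 1 ≤ K → K < r → dim K + K + K ≡ N)
  (pal : ∀ j → 1 ≤ j → j < N → m (N ∸ j) ≡ m j) where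

  blockCoeff : ℕ → ℕ → ℤ
  blockCoeff K j = εℤ (m K) (m (K + j))

  block : (K : ℕ) → Mat (dim K)
  block K = Btilde (dim K) (r ∸ K) (blockCoeff K)

  blocks : Mat N
  blocks = sumMat1 (r ∸ 1) (λ K → embed K (block K))

  decomposition : Mat N
  decomposition = Btilde N r m +ₘ blocks

  private
    block-half′ : ∀ {i} → i < r ∸ 1 → FloorHalf (dim (suc i)) (r ∸ suc i)
    block-half′ i<r∸1 = block-half _ (s≤s z≤n) (<∸1⇒suc< i<r∸1)

  decomposition-skew : SkewSymmetric decomposition
  decomposition-skew = +ₘ-skew (Btilde-skew {N} {r} half m)
    (sumMat0-skew (r ∸ 1) (λ i → embed (suc i) (block (suc i)))
      (λ i i<r∸1 → embed-skew (suc i) (Btilde-skew {dim (suc i)} {r ∸ suc i} (block-half′ i<r∸1) (blockCoeff (suc i)))))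

  inBlock? : ∀ K y d → Dec (K ≤ y × y + d + K < N)
  inBlock? K y d = (K ≤? y) ×-dec (y + d + K <? N)

  blockValue : ℕ → ℕ → ℤ
  blockValue K d = at (block K) d 0

  blockSum : ℕ → ℕ → ℤ
  blockSum y d = ∑< (r ∸ 1) (λ i → 𝟙 (inBlock? (suc i) y d) *ℤ blockValue (suc i) d)

  at-decomposition-lower : ∀ y d → 1 ≤ d → y + d < N →
    at decomposition (y + d) y ≡ at (Btilde N r m) d 0 +ℤ blockSum y d
  at-decomposition-lower y d 1≤d y+d<N = begin
    at decomposition (y + d) y                                    ≡⟨ at-+ₘ (Btilde N r m) blocks (y + d) y y+d<N y<N ⟩
    at (Btilde N r m) (y + d) y +ℤ at blocks (y + d) y           ≡⟨ cong₂ _+ℤ_ (at-Btilde-toeplitz {N} {r} half m y d 1≤d y+d<N)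
                                                                                (at-sumMat0 (r ∸ 1) embedded (y + d) y y+d<N y<N) ⟩
    at (Btilde N r m) d 0 +ℤ ∑< (r ∸ 1) (λ i → at (embedded i) (y + d) y)
      ≡⟨ cong (at (Btilde N r m) d 0 +ℤ_) (∑<-cong (r ∸ 1) (λ i i<r∸1 →
           at-embed-lower (suc i) (block (suc i)) (at-Btilde-toeplitz {dim (suc i)} {r ∸ suc i} (block-half′ i<r∸1) (blockCoeff (suc i)))
                          (block-dim (suc i) (s≤s z≤n) (<∸1⇒suc< i<r∸1)) y d 1≤d y+d<N)) ⟩
    at (Btilde N r m) d 0 +ℤ blockSum y d  ∎
    where
    open ≡-Reasoning
    y<N = ℕₚ.≤-<-trans (ℕₚ.m≤m+n y d) y+d<N
    embedded : ℕ → Mat N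
    embedded i = embed (suc i) (block (suc i))

  decomposition-first-column : ∀ x → 1 ≤ x → x < N → at decomposition x 0 ≡ m x
  decomposition-first-column x 1≤x x<N = begin
    at decomposition x 0                   ≡⟨ at-decomposition-lower 0 x 1≤x x<N ⟩
    at (Btilde N r m) x 0 +ℤ blockSum 0 x  ≡⟨ cong (at (Btilde N r m) x 0 +ℤ_) (∑<-zero (r ∸ 1) outside) ⟩
    at (Btilde N r m) x 0 +ℤ + 0           ≡⟨ ℤₚ.+-identityʳ _ ⟩
    at (Btilde N r m) x 0                  ≡⟨ by-position (x ≤? r) ⟩
    m x                                    ∎
    where
    open ≡-Reasoning
    outside : ∀ i → i < r ∸ 1 → 𝟙 (inBlock? (suc i) 0 x) *ℤ blockValue (suc i) x ≡ + 0
    outside i _ = trans (cong (_*ℤ blockValue (suc i) x) (𝟙-no (inBlock? (suc i) 0 x) (λ ())))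
                        (ℤₚ.*-zeroˡ (blockValue (suc i) x))
    by-position : Dec (x ≤ r) → at (Btilde N r m) x 0 ≡ m x
    by-position (yes x≤r) = at-Btilde-lower-≤ {N} {r} half m 0 x 1≤x x≤r x<N
    by-position (no x≰r) = trans (at-Btilde-lower-> {N} {r} half m 0 x (ℕₚ.≰⇒> x≰r) x<N) (pal x 1≤x x<N)

  blockValue-≤ : ∀ K d → 1 ≤ K → K < r → 1 ≤ d → d ≤ r ∸ K → d < dim K → blockValue K d ≡ εℤ (m K) (m (K + d))
  blockValue-≤ K d 1≤K K<r = at-Btilde-lower-≤ {dim K} {r ∸ K} (block-half K 1≤K K<r) (blockCoeff K) 0 d

  blockValue-> : ∀ K d → 1 ≤ K → K < r → r ∸ K < d → d < dim K → blockValue K d ≡ εℤ (m K) (m (K + (dim K ∸ d)))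
  blockValue-> K d 1≤K K<r = at-Btilde-lower-> {dim K} {r ∸ K} (block-half K 1≤K K<r) (blockCoeff K) 0 d

  private
    mirror-block : ∀ K d → 1 ≤ K → K < r → d < dim K → K + (dim K ∸ d) + (K + d) ≡ N
    mirror-block K d 1≤K K<r d<dim = begin
      K + (dim K ∸ d) + (K + d)      ≡⟨ rearrange K (dim K ∸ d) d ⟩
      dim K ∸ d + d + K + K          ≡⟨ cong (λ w → w + K + K) (ℕₚ.m∸n+n≡m (ℕₚ.<⇒≤ d<dim)) ⟩
      dim K + K + K                  ≡⟨ block-dim K 1≤K K<r ⟩
      N                              ∎
      where
      open ≡-Reasoning
      rearrange : ∀ k a d → k + a + (k + d) ≡ a + d + k + k
      rearrange = ℕ-solve-∀

    mirror-index : ∀ K d → 1 ≤ K → K < r → d < dim K → K + (dim K ∸ d) ≡ N ∸ (K + d)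
    mirror-index K d 1≤K K<r d<dim =
      trans (sym (ℕₚ.m+n∸n≡m (K + (dim K ∸ d)) (K + d))) (cong (_∸ (K + d)) (mirror-block K d 1≤K K<r d<dim))

    below-dim : ∀ K d → 1 ≤ K → K < r → d + K + K < N → d < dim K
    below-dim K d 1≤K K<r lt = ℕₚ.+-cancelʳ-< K d (dim K) (ℕₚ.+-cancelʳ-< K (d + K) (dim K + K)
      (subst (d + K + K <_) (sym (block-dim K 1≤K K<r)) lt))

    entering-index<r : ∀ y d → 1 ≤ d → suc y + d + suc y < N → suc y < r
    entering-index<r y d 1≤d Q<N = FloorHalf-double< half (ℕₚ.≤-<-trans (ℕₚ.+-monoˡ-≤ (suc y) (ℕₚ.m<m+n (suc y) 1≤d)) Q<N)

    leaving-index-sum : ∀ y d → suc y + d < N → N ∸ suc (y + d) + suc (y + d) ≡ N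
    leaving-index-sum y d sy+d<N = ℕₚ.m∸n+n≡m (ℕₚ.<⇒≤ sy+d<N)

    leaving-index≤ : ∀ y d → N < suc y + d + suc y → suc y + d < N → N ∸ suc (y + d) ≤ y
    leaving-index≤ y d N<Q sy+d<N = ℕₚ.≤-pred (ℕₚ.+-cancelʳ-< (suc (y + d)) (N ∸ suc (y + d)) (suc y)
      (subst₂ _<_ (sym (leaving-index-sum y d sy+d<N)) (ℕₚ.+-comm (suc (y + d)) (suc y)) N<Q))

    leaving-index<r : ∀ y d → 1 ≤ d → N < suc y + d + suc y → suc y + d < N → N ∸ suc (y + d) < r
    leaving-index<r y d 1≤d N<Q sy+d<N = FloorHalf-double< half
      (subst (suc (K₀ + K₀) <_) (trans (sym (ℕₚ.+-suc K₀ (y + d))) (leaving-index-sum y d sy+d<N))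
        (s≤s (ℕₚ.+-monoʳ-< K₀ (ℕₚ.≤-<-trans (leaving-index≤ y d N<Q sy+d<N) (ℕₚ.m<m+n y 1≤d)))))
      where K₀ = N ∸ suc (y + d)

  entering-value : ∀ y d → 1 ≤ d → suc y + d + suc y < N → blockValue (suc y) d ≡ - εℤ (m (suc y + d)) (m (suc y))
  entering-value y d 1≤d Q<N = by-position (d ≤? r ∸ K)
    where
    K = suc y
    K<r = entering-index<r y d 1≤d Q<N
    d<dim : d < dim K
    d<dim = below-dim K d (s≤s z≤n) K<r (subst (_< N) (cong (_+ K) (ℕₚ.+-comm K d)) Q<N)
    by-position : Dec (d ≤ r ∸ K) → blockValue K d ≡ - εℤ (m (K + d)) (m K)
    by-position (yes d≤) = trans (blockValue-≤ K d (s≤s z≤n) K<r 1≤d d≤ d<dim) (εℤ-antisym (m K) (m (K + d)))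
    by-position (no d≰) = begin
      blockValue K d                       ≡⟨ blockValue-> K d (s≤s z≤n) K<r (ℕₚ.≰⇒> d≰) d<dim ⟩
      εℤ (m K) (m (K + (dim K ∸ d)))       ≡⟨ cong (λ w → εℤ (m K) (m w)) (mirror-index K d (s≤s z≤n) K<r d<dim) ⟩
      εℤ (m K) (m (N ∸ (K + d)))           ≡⟨ cong (λ w → εℤ (m K) w) (pal (K + d) (s≤s z≤n) (ℕₚ.≤-<-trans (ℕₚ.m≤m+n (K + d) K) Q<N)) ⟩
      εℤ (m K) (m (K + d))                 ≡⟨ εℤ-antisym (m K) (m (K + d)) ⟩
      - εℤ (m (K + d)) (m K)               ∎
      where open ≡-Reasoning

  leaving-value : ∀ y d → 1 ≤ d → N < suc y + d + suc y → suc y + d < N →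
    blockValue (N ∸ suc (y + d)) d ≡ εℤ (m (suc y + d)) (m (suc y))
  leaving-value y d 1≤d N<Q sy+d<N = by-position (d ≤? r ∸ K₀)
    where
    K₀ = N ∸ suc (y + d)
    K₀+sy+d≡N = leaving-index-sum y d sy+d<N
    1≤K₀ = ℕₚ.m<n⇒0<n∸m sy+d<N
    K₀≤y = leaving-index≤ y d N<Q sy+d<N
    K₀<r = leaving-index<r y d 1≤d N<Q sy+d<N
    dim+K₀ : dim K₀ + K₀ ≡ suc (y + d)
    dim+K₀ = ℕₚ.+-cancelʳ-≡ K₀ (dim K₀ + K₀) (suc (y + d))
               (trans (block-dim K₀ 1≤K₀ K₀<r) (trans (sym K₀+sy+d≡N) (ℕₚ.+-comm K₀ (suc (y + d)))))
    d<dim : d < dim K₀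
    d<dim = ℕₚ.+-cancelʳ-< K₀ d (dim K₀) (subst (d + K₀ <_) (sym dim+K₀)
              (s≤s (ℕₚ.≤-trans (ℕₚ.+-monoʳ-≤ d K₀≤y) (ℕₚ.≤-reflexive (ℕₚ.+-comm d y)))))
    mK₀ : m K₀ ≡ m (suc y + d)
    mK₀ = pal (suc (y + d)) (s≤s z≤n) sy+d<N
    by-position : Dec (d ≤ r ∸ K₀) → blockValue K₀ d ≡ εℤ (m (suc y + d)) (m (suc y))
    by-position (yes d≤) = begin
      blockValue K₀ d                 ≡⟨ blockValue-≤ K₀ d 1≤K₀ K₀<r 1≤d d≤ d<dim ⟩
      εℤ (m K₀) (m (K₀ + d))          ≡⟨ cong₂ (λ a b → εℤ a (m b)) mK₀ K₀+d≡N∸sy ⟩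
      εℤ (m (suc y + d)) (m (N ∸ suc y))  ≡⟨ cong (εℤ (m (suc y + d))) (pal (suc y) (s≤s z≤n) sy<N) ⟩
      εℤ (m (suc y + d)) (m (suc y))  ∎
      where
      open ≡-Reasoning
      sy<N = ℕₚ.≤-<-trans (ℕₚ.m≤m+n (suc y) d) sy+d<N
      shift : ∀ k d y → k + d + suc y ≡ k + suc (y + d)
      shift = ℕ-solve-∀
      K₀+d≡N∸sy : K₀ + d ≡ N ∸ suc y
      K₀+d≡N∸sy = trans (sym (ℕₚ.m+n∸n≡m (K₀ + d) (suc y))) (cong (_∸ suc y) (trans (shift K₀ d y) K₀+sy+d≡N))
    by-position (no d≰) = begin
      blockValue K₀ d                      ≡⟨ blockValue-> K₀ d 1≤K₀ K₀<r (ℕₚ.≰⇒> d≰) d<dim ⟩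
      εℤ (m K₀) (m (K₀ + (dim K₀ ∸ d)))    ≡⟨ cong₂ (λ a b → εℤ a (m b)) mK₀ mirror ⟩
      εℤ (m (suc y + d)) (m (suc y))       ∎
      where
      open ≡-Reasoning
      mirror : K₀ + (dim K₀ ∸ d) ≡ suc y
      mirror = ℕₚ.+-cancelʳ-≡ d (K₀ + (dim K₀ ∸ d)) (suc y) (begin
        K₀ + (dim K₀ ∸ d) + d     ≡⟨ ℕₚ.+-assoc K₀ (dim K₀ ∸ d) d ⟩
        K₀ + (dim K₀ ∸ d + d)     ≡⟨ cong (λ w → K₀ + w) (ℕₚ.m∸n+n≡m (ℕₚ.<⇒≤ d<dim)) ⟩
        K₀ + dim K₀               ≡⟨ ℕₚ.+-comm K₀ (dim K₀) ⟩
        dim K₀ + K₀               ≡⟨ dim+K₀ ⟩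
        suc y + d                 ∎)

  stationary-ε : ∀ y d → 1 ≤ d → suc y + d + suc y ≡ N → εℤ (m (suc y + d)) (m (suc y)) ≡ + 0
  stationary-ε y d 1≤d Q≡N = trans (cong (λ w → εℤ w (m (suc y))) (trans (cong m sy+d≡N∸sy) (pal (suc y) (s≤s z≤n) sy<N)))
                                   (εℤ-diag (m (suc y)))
    where
    sy+d≡N∸sy : suc y + d ≡ N ∸ suc y
    sy+d≡N∸sy = trans (sym (ℕₚ.m+n∸n≡m (suc y + d) (suc y))) (cong (_∸ suc y) Q≡N)
    sy<N : suc y < N
    sy<N = subst (suc y <_) Q≡N (ℕₚ.<-≤-trans (ℕₚ.m<m+n (suc y) 1≤d) (ℕₚ.m≤m+n (suc y + d) (suc y)))

  private
    inBlock-entering : ∀ K y d → suc y + d + suc y < N → 𝟙 (inBlock? K (suc y) d) ≡ 𝟙 (inBlock? K y d) +ℤ 𝟙 (K ≟ suc y)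
    inBlock-entering K y d Q<N = 𝟙-⊎ (inBlock? K (suc y) d) (inBlock? K y d) (K ≟ suc y) split from-old from-new disjoint
      where
      split : K ≤ suc y × suc y + d + K < N → (K ≤ y × y + d + K < N) ⊎ K ≡ suc y
      split (K≤sy , inside) with K ≟ suc y
      ... | yes K≡sy = inj₂ K≡sy
      ... | no K≢sy = inj₁ (ℕₚ.≤-pred (ℕₚ.≤∧≢⇒< K≤sy K≢sy) , ℕₚ.<-trans (ℕₚ.n<1+n _) inside)
      from-old : K ≤ y × y + d + K < N → K ≤ suc y × suc y + d + K < N
      from-old (K≤y , _) = ℕₚ.≤-trans K≤y (ℕₚ.n≤1+n y) ,
        ℕₚ.≤-<-trans (ℕₚ.+-monoʳ-≤ (suc y + d) K≤y) (ℕₚ.<-trans (ℕₚ.+-monoʳ-< (suc y + d) (ℕₚ.n<1+n y)) Q<N)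
      from-new : K ≡ suc y → K ≤ suc y × suc y + d + K < N
      from-new refl = ℕₚ.≤-refl , Q<N
      disjoint : K ≤ y × y + d + K < N → K ≢ suc y
      disjoint (K≤y , _) refl = ℕₚ.<-irrefl refl K≤y

    inBlock-stationary : ∀ K y d → suc y + d + suc y ≡ N → 𝟙 (inBlock? K (suc y) d) ≡ 𝟙 (inBlock? K y d)
    inBlock-stationary K y d Q≡N = 𝟙-cong (inBlock? K (suc y) d) (inBlock? K y d) to from
      where
      to : K ≤ suc y × suc y + d + K < N → K ≤ y × y + d + K < N
      to (_ , inside) = ℕₚ.≤-pred (ℕₚ.+-cancelˡ-< (suc y + d) K (suc y) (subst (suc y + d + K <_) (sym Q≡N) inside)) ,
                        ℕₚ.<-trans (ℕₚ.n<1+n _) inside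
      from : K ≤ y × y + d + K < N → K ≤ suc y × suc y + d + K < N
      from (K≤y , _) = ℕₚ.≤-trans K≤y (ℕₚ.n≤1+n y) , subst (suc y + d + K <_) Q≡N (ℕₚ.+-monoʳ-< (suc y + d) (s≤s K≤y))

    inBlock-leaving : ∀ K y d → N < suc y + d + suc y → suc y + d < N →
      𝟙 (inBlock? K y d) ≡ 𝟙 (inBlock? K (suc y) d) +ℤ 𝟙 (K ≟ N ∸ suc (y + d))
    inBlock-leaving K y d N<Q sy+d<N =
      𝟙-⊎ (inBlock? K y d) (inBlock? K (suc y) d) (K ≟ K₀) split from-new from-leaving disjoint
      where
      K₀ = N ∸ suc (y + d)
      split : K ≤ y × y + d + K < N → (K ≤ suc y × suc y + d + K < N) ⊎ K ≡ K₀
      split (K≤y , inside) with suc y + d + K <? N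
      ... | yes inside′ = inj₁ (ℕₚ.≤-trans K≤y (ℕₚ.n≤1+n y) , inside′)
      ... | no outside′ = inj₂ (trans (sym (ℕₚ.m+n∸n≡m K (suc (y + d))))
                                      (cong (_∸ suc (y + d)) (trans (ℕₚ.+-comm K (suc (y + d))) (ℕₚ.≤-antisym inside (ℕₚ.≮⇒≥ outside′)))))
      from-new : K ≤ suc y × suc y + d + K < N → K ≤ y × y + d + K < N
      from-new (_ , inside′) = ℕₚ.≤-pred (ℕₚ.+-cancelˡ-< (suc y + d) K (suc y) (ℕₚ.<-trans inside′ N<Q)) ,
                               ℕₚ.<-trans (ℕₚ.n<1+n _) inside′
      from-leaving : K ≡ K₀ → K ≤ y × y + d + K < N
      from-leaving refl = leaving-index≤ y d N<Q sy+d<N ,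
        ℕₚ.≤-reflexive (trans (ℕₚ.+-comm (suc (y + d)) K₀) (leaving-index-sum y d sy+d<N))
      disjoint : K ≤ suc y × suc y + d + K < N → K ≢ K₀
      disjoint (_ , inside′) refl = ℕₚ.<-irrefl (trans (ℕₚ.+-comm (suc (y + d)) K₀) (leaving-index-sum y d sy+d<N)) inside′

    blockSum-select : ∀ K d → 1 ≤ K → K < r → ∑< (r ∸ 1) (λ i → 𝟙 (suc i ≟ K) *ℤ blockValue (suc i) d) ≡ blockValue K d
    blockSum-select (suc j) d _ K<r =
      trans (∑<-cong (r ∸ 1) (λ i _ → cong (_*ℤ blockValue (suc i) d) (𝟙-cong (suc i ≟ suc j) (i ≟ j) ℕₚ.suc-injective (cong suc))))
            (∑<-select (r ∸ 1) j (λ i → blockValue (suc i) d) (suc<⇒<∸1 K<r))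

  -- Between (y + d, y) and (y + 1 + d, y + 1) the block K = y + 1 enters when 2(y + 1) + d < N, and the block
  -- K = N - (y + 1 + d) leaves when 2(y + 1) + d > N.
  blockSum-step : ∀ y d → 1 ≤ d → suc y + d < N → blockSum (suc y) d ≡ blockSum y d -ℤ εℤ (m (suc y + d)) (m (suc y))
  blockSum-step y d 1≤d sy+d<N with ℕₚ.<-cmp (suc y + d + suc y) N
  ... | tri< Q<N _ _ = begin
    blockSum (suc y) d
        ≡⟨ ∑<-split (r ∸ 1) {λ i → 𝟙 (inBlock? (suc i) (suc y) d)} {λ i → 𝟙 (inBlock? (suc i) y d)} {λ i → 𝟙 (suc i ≟ suc y)}
                    v (λ i _ → inBlock-entering (suc i) y d Q<N) ⟩
    blockSum y d +ℤ ∑< (r ∸ 1) (λ i → 𝟙 (suc i ≟ suc y) *ℤ v i)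
                                                ≡⟨ cong (blockSum y d +ℤ_) (blockSum-select (suc y) d (s≤s z≤n) (entering-index<r y d 1≤d Q<N)) ⟩
    blockSum y d +ℤ blockValue (suc y) d        ≡⟨ cong (blockSum y d +ℤ_) (entering-value y d 1≤d Q<N) ⟩
    blockSum y d -ℤ εℤ (m (suc y + d)) (m (suc y))  ∎
    where
    open ≡-Reasoning
    v = λ i → blockValue (suc i) d
  ... | tri≈ _ Q≡N _ = begin
    blockSum (suc y) d                          ≡⟨ ∑<-cong (r ∸ 1) (λ i _ → cong (_*ℤ blockValue (suc i) d) (inBlock-stationary (suc i) y d Q≡N)) ⟩
    blockSum y d                                ≡⟨ ℤₚ.+-identityʳ (blockSum y d) ⟨
    blockSum y d -ℤ + 0                         ≡⟨ cong (blockSum y d -ℤ_) (stationary-ε y d 1≤d Q≡N) ⟨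
    blockSum y d -ℤ εℤ (m (suc y + d)) (m (suc y))  ∎
    where open ≡-Reasoning
  ... | tri> _ _ N<Q = move-right (begin
    blockSum y d
        ≡⟨ ∑<-split (r ∸ 1) {λ i → 𝟙 (inBlock? (suc i) y d)} {λ i → 𝟙 (inBlock? (suc i) (suc y) d)} {λ i → 𝟙 (suc i ≟ K₀)}
                    v (λ i _ → inBlock-leaving (suc i) y d N<Q sy+d<N) ⟩
    blockSum (suc y) d +ℤ ∑< (r ∸ 1) (λ i → 𝟙 (suc i ≟ K₀) *ℤ v i)
                                                ≡⟨ cong (blockSum (suc y) d +ℤ_) (blockSum-select K₀ d (ℕₚ.m<n⇒0<n∸m sy+d<N) (leaving-index<r y d 1≤d N<Q sy+d<N)) ⟩
    blockSum (suc y) d +ℤ blockValue K₀ d       ≡⟨ cong (blockSum (suc y) d +ℤ_) (leaving-value y d 1≤d N<Q sy+d<N) ⟩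
    blockSum (suc y) d +ℤ εℤ (m (suc y + d)) (m (suc y))  ∎)
    where
    open ≡-Reasoning
    K₀ = N ∸ suc (y + d)
    v = λ i → blockValue (suc i) d
    move-right : ∀ {a b e} → a ≡ b +ℤ e → b ≡ a -ℤ e
    move-right {a} {b} {e} refl = sym (cancel b e)
      where
      cancel : ∀ b e → b +ℤ e -ℤ e ≡ b
      cancel = solve-∀

  decomposition-step : ∀ y d → 1 ≤ d → suc y + d < N →
    at decomposition (suc y + d) (suc y) ≡ at decomposition (y + d) y -ℤ εℤ (m (suc y + d)) (m (suc y))
  decomposition-step y d 1≤d sy+d<N = begin
    at decomposition (suc y + d) (suc y)        ≡⟨ at-decomposition-lower (suc y) d 1≤d sy+d<N ⟩
    β +ℤ blockSum (suc y) d                     ≡⟨ cong (β +ℤ_) (blockSum-step y d 1≤d sy+d<N) ⟩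
    β +ℤ (blockSum y d -ℤ e)                    ≡⟨ ℤₚ.+-assoc β (blockSum y d) (- e) ⟨
    β +ℤ blockSum y d -ℤ e                      ≡⟨ cong (_-ℤ e) (at-decomposition-lower y d 1≤d (ℕₚ.<-trans (ℕₚ.n<1+n _) sy+d<N)) ⟨
    at decomposition (y + d) y -ℤ e             ∎
    where
    open ≡-Reasoning
    β = at (Btilde N r m) d 0
    e = εℤ (m (suc y + d)) (m (suc y))

  decomposition-recurrence : Period1Recurrence m decomposition
  decomposition-recurrence = record
    { skew = decomposition-skew
    ; first-column = decomposition-first-column
    ; step = decomposition-step
    }

decomposition-theorem : ∀ N r (dim : ℕ → ℕ) → FloorHalf N r →
  (∀ K → 1 ≤ K → K < r → FloorHalf (dim K) (r ∸ K)) → (∀ K → 1 ≤ K → K < r → dim K + K + K ≡ N) →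
  (B : Mat N) → SkewSymmetric B → MutationPeriod1 B →
  B ≈ₘ (Btilde N r (mcoef B) +ₘ sumMat1 (r ∸ 1) (λ k → embed k (Btilde (dim k) (r ∸ k) (λ j → ε B k (k + j)))))
decomposition-theorem zero r dim half block-half block-dim B skew period ()
decomposition-theorem (suc N) r dim half block-half block-dim B skew period =
  Period1Recurrence-unique recurrence (decomposition-recurrence pal)
  where
  recurrence = period1-recurrence B skew period
  pal = palindrome recurrence (mutation-last-row B skew period)
  open Decomposition (suc N) r dim (mcoef B) half block-half block-dim using (decomposition-recurrence)

block-dim-even : ∀ r K → K < r → (r ∸ K) + (r ∸ K) + K + K ≡ r + r
block-dim-even r K K<r = trans (regroup (r ∸ K) K) (cong (λ w → w + w) (ℕₚ.m∸n+n≡m (ℕₚ.<⇒≤ K<r)))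
  where
  regroup : ∀ a K → a + a + K + K ≡ (a + K) + (a + K)
  regroup = ℕ-solve-∀

mainTheorem11 :
    ((r : ℕ) (B : Mat (r + r)) → SkewSymmetric B → MutationPeriod1 B →
      B ≈ₘ (Btilde (r + r) r (mcoef B)
            +ₘ sumMat1 (r ∸ 1) (λ k → embed k (Btilde ((r ∸ k) + (r ∸ k)) (r ∸ k) (λ j → ε B k (k + j))))))
    ×
    ((r : ℕ) (B : Mat (suc (r + r))) → SkewSymmetric B → MutationPeriod1 B →
      B ≈ₘ (Btilde (suc (r + r)) r (mcoef B)
            +ₘ sumMat1 (r ∸ 1) (λ k → embed k (Btilde (suc ((r ∸ k) + (r ∸ k))) (r ∸ k) (λ j → ε B k (k + j))))))
mainTheorem11 =
  (λ r → decomposition-theorem (r + r) r (λ k → (r ∸ k) + (r ∸ k))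
           (inj₁ refl) (λ _ _ _ → inj₁ refl) (λ K _ K<r → block-dim-even r K K<r)) ,
  (λ r → decomposition-theorem (suc (r + r)) r (λ k → suc ((r ∸ k) + (r ∸ k)))
           (inj₂ refl) (λ _ _ _ → inj₂ refl) (λ K _ K<r → cong suc (block-dim-even r K K<r)))
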